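{- For each integer $t\ge 0$ we have $n_2(5,9+16t,2)=20+31t$, $n_2(5,10+16t,2)=21+31t$, $n_2(5,11+16t,2)=23+31t$, $n_2(5,12+16t,2)=24+31t$, $n_2(5,13+16t,2)=27+31t$, $n_2(5,14+16t,2)=28+31t$, $n_2(5,15+16t,2)=30+31t$, $n_2(5,16+16t,2)=31+31t$, $n_2(5,17+16t,2)=36+31t$, $n_2(5,18+16t,2)=37+31t$, $n_2(5,19+16t,2)=39+31t$, $n_2(5,20+16t,2)=40+31t$, $n_2(5,21+16t,2)=43+31t$, $n_2(5,22+16t,2)=44+31t$, $n_2(5,23+16t,2)=46+31t$, and $n_2(5,24+16t,2)=47+31t$. Moreover, $n_2(5,1,2)=n_2(5,2,2)=8$, $n_2(5,3,2)=10$, $n_2(5,4,2)=11$, $n_2(5,5,2)=13$, $n_2(5,6,2)=14$, $n_2(5,7,2)=16$, and $n_2(5,8,2)=17$.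
   Context: An $[n,k,d]_q$-code is a $k$-dimensional subspace of $\mathbb{F}_q^n$ with minimum Hamming distance at least $d$. A linear code $C\subseteq\mathbb{F}_q^n$ has locality $r$ if for every coordinate $i$ there is a set $S_i\subseteq\{1,\dots,n\}\setminus\{i\}$ with $|S_i|\le r$ such that any two codewords agreeing on all coordinates in $S_i$ also agree in coordinate $i$. $n_q(k,d,r)$ denotes the minimum length $n$ of an $[n,k,d]_q$-code with locality $r$. -}

module Defs where

open import Data.Nat using (ℕ; zero; suc; _+_; _≤_; _<_)
open import Data.Bool using (Bool; true; false; if_then_else_; _xor_)
open import Data.Fin using (Fin)
open import Data.Fin.Subset using (Subset; _∈_; _∉_; ∣_∣)
open import Data.Vec using (Vec; []; _∷_; replicate; zipWith; lookup)
open import Data.Product using (Σ; _×_)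
open import Relation.Binary.PropositionalEquality using (_≡_; _≢_)
open import Relation.Nullary using (¬_)

-- Words of F_2^n, with F_2 = Bool (false = 0, true = 1, xor = addition).
Word : ℕ → Set
Word n = Vec Bool n

_⊕_ : ∀ {n} → Word n → Word n → Word n
_⊕_ = zipWith _xor_

GenMat : ℕ → ℕ → Set
GenMat k n = Vec (Word n) k

encode : ∀ {k n} → GenMat k n → Word k → Word n
encode {n = n} [] [] = replicate n false
encode (g ∷ G) (b ∷ x) = (if b then g else replicate _ false) ⊕ encode G x

dist : ∀ {n} → Word n → Word n → ℕ
dist [] [] = 0
dist (a ∷ u) (b ∷ v) = (if a xor b then 1 else 0) + dist u v

-- C = image of encode G is a k-dimensional subspace: encode G is injective.
IsDimK : ∀ {k n} → GenMat k n → Set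
IsDimK G = ∀ x y → encode G x ≡ encode G y → x ≡ y

MinDistAtLeast : ∀ {k n} → GenMat k n → ℕ → Set
MinDistAtLeast G d = ∀ x y → encode G x ≢ encode G y →
  d ≤ dist (encode G x) (encode G y)

HasLocality : ∀ {k n} → GenMat k n → ℕ → Set
HasLocality {n = n} G r = (i : Fin n) → Σ (Subset n) λ S →
  i ∉ S × ∣ S ∣ ≤ r ×
  (∀ x y → (∀ j → j ∈ S → lookup (encode G x) j ≡ lookup (encode G y) j) →
           lookup (encode G x) i ≡ lookup (encode G y) i)

HasCode : ℕ → ℕ → ℕ → ℕ → Set
HasCode n k d r = Σ (GenMat k n) λ G → IsDimK G × MinDistAtLeast G d × HasLocality G r

MinLength≡ : ℕ → ℕ → ℕ → ℕ → Set
MinLength≡ k d r N = HasCode N k d r × (∀ m → m < N → ¬ HasCode m k d r)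

-- A code of dimension k and length n is given by its n columns in F₂^k; the weight of the codeword
-- of a message y is the number of columns not orthogonal to y. Counting zero columns as well, the
-- Griesmer bound (zero columns) + Σ_{i<k} ⌈d/2^i⌉ ≤ n follows by passing to the residual code of a
-- codeword of minimum weight. With locality 2 some nonzero column lies in the span of two others;
-- projecting along one of them either kills two columns at the cost of one dimension or, after a
-- second projection, a whole triangle of three columns at the cost of two, and induction on the
-- dimension sharpens the bound. For d = 3, 4 the triangle must be excluded outright: in a code that
-- is too short, collapsing a triangle maps the remaining columns injectively into the Fano plane,
-- each on a line with its recovery pair, and a second triangle yields two disjoint lines.
-- The matching codes are explicit and checked by computation. For the infinite families, appending
-- t copies of the simplex code [31, 5, 16], which has locality 2, raises n by 31 t and d by 16 t,
-- exactly as much as the Griesmer bound grows.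
module Submission where

open import Defs
open import Algebra.Bundles using (CommutativeRing; CommutativeMonoid)
open import Data.Bool using (Bool; true; false; not; _∧_; _xor_; if_then_else_)
open import Data.Bool.Properties as Bool
  using (∧-identityʳ; ∧-zeroʳ; ∧-comm; xor-comm; xor-identityʳ; xor-same; ∧-distribʳ-xor;
         xor-∧-commutativeRing)
open import Algebra.Properties.CommutativeSemigroup
  (CommutativeMonoid.commutativeSemigroup (CommutativeRing.+-commutativeMonoid xor-∧-commutativeRing))
  using () renaming (interchange to xor-interchange)
open import Data.Empty using (⊥; ⊥-elim)
open import Data.Fin using (Fin; zero; suc; toℕ; splitAt; _↑ˡ_; _↑ʳ_)
import Data.Fin.Properties as Fin
open import Data.Fin.Subset using (Subset; ⁅_⁆; _∪_; ∣_∣; _-_) renaming (_∈_ to _∈ₛ_; _∉_ to _∉ₛ_)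
open import Data.Fin.Subset.Properties
  using (∣p∣≤∣x∷p∣; ∣⁅x⁆∣≡1; x∈⁅x⁆; x∈⁅y⁆⇒x≡y; x∈p∪q⁺; x∈p∪q⁻; p─q⊆p; x∈p∧x≢y⇒x∈p-y; x∈p⇒∣p-x∣<∣p∣)
  renaming (_∈?_ to _∈ₛ?_)
open import Data.List using (List; []; _∷_; length; map; lookup) renaming (_++_ to _++ˡ_)
open import Data.List.Membership.Propositional using (_∈_; _∉_; find)
open import Data.List.Membership.Propositional.Properties using (∈-map⁻; ∈-++⁺ˡ; ∈-++⁺ʳ)
open import Data.List.Relation.Unary.All as All using (All; []; _∷_)
open import Data.List.Relation.Unary.All.Properties using (¬Any⇒All¬)
open import Data.List.Relation.Unary.AllPairs using ([]; _∷_)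
open import Data.List.Relation.Unary.Any as Any using (Any; here; there)
open import Data.List.Relation.Unary.Any.Properties using (lookup-index; map⁻)
open import Data.List.Relation.Unary.Unique.Propositional using (Unique)
open import Data.Nat
  using (ℕ; zero; suc; _+_; _*_; _^_; _%_; _≡ᵇ_; _≤_; _<_; z≤n; s≤s; _≤?_; _⊔_; _⊓_; ⌈_/2⌉; ⌊_/2⌋;
         NonZero; >-nonZero⁻¹)
open import Data.Nat.Properties
open import Algebra.Properties.CommutativeMonoid.Sum +-0-commutativeMonoid
  using (sum; ∑-distrib-+; sum-cong-≗)
open import Data.Nat.Tactic.RingSolver using (solve-∀)
open import Data.Product using (Σ; ∃; ∃₂; _×_; _,_; proj₁; proj₂)
open import Data.Sum using (_⊎_; inj₁; inj₂)
open import Data.Sum.Properties using ([,]-∘; [,]-map)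
open import Data.Vec using (Vec; []; _∷_; replicate)
import Data.Vec as Vec
open import Data.Vec.Properties
  using (≡-dec; ∷-injective; lookup-replicate; lookup-zipWith; tabulate-∘; tabulate-cong; lookup∘tabulate;
         tabulate∘lookup)
open import Data.Vec.Functional using (_++_)
open import Data.Vec.Functional.Properties using (lookup-++ˡ; lookup-++ʳ)
open import Function using (_∘_)
open import Relation.Binary.PropositionalEquality
open import Relation.Nullary using (Dec; yes; no; does; contradiction)
open import Relation.Nullary.Decidable
  using (True; toWitness; dec-true; dec-false; ¬?; _→-dec_; _×-dec_; _⊎-dec_)

-- Linear algebra over F₂

0ʷ : ∀ {s} → Word s
0ʷ = replicate _ false

infix 4 _≟ʷ_
_≟ʷ_ : ∀ {s} (x y : Word s) → Dec (x ≡ y)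
_≟ʷ_ = ≡-dec Bool._≟_

isZero : ∀ {s} → Word s → Bool
isZero x = does (x ≟ʷ 0ʷ)

isZero-0ʷ : ∀ {s} → isZero (0ʷ {s}) ≡ true
isZero-0ʷ {s} = dec-true (0ʷ {s} ≟ʷ 0ʷ) refl

isZero⇒≡0ʷ : ∀ {s} (x : Word s) → isZero x ≡ true → x ≡ 0ʷ
isZero⇒≡0ʷ x h with x ≟ʷ 0ʷ
... | yes x≡0 = x≡0

infixl 7 _·_
_·_ : ∀ {s} → Word s → Word s → Bool
[] · [] = false
(a ∷ x) · (b ∷ y) = (a ∧ b) xor (x · y)

·-comm : ∀ {s} (x y : Word s) → x · y ≡ y · x
·-comm [] [] = refl
·-comm (a ∷ x) (b ∷ y) = cong₂ _xor_ (∧-comm a b) (·-comm x y)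

·-zeroʳ : ∀ {s} (y : Word s) → y · 0ʷ ≡ false
·-zeroʳ [] = refl
·-zeroʳ (a ∷ y) = cong₂ _xor_ (∧-zeroʳ a) (·-zeroʳ y)

·-zeroˡ : ∀ {s} (c : Word s) → 0ʷ · c ≡ false
·-zeroˡ c = trans (·-comm 0ʷ c) (·-zeroʳ c)

·-distribʳ-⊕ : ∀ {s} (x y c : Word s) → (x ⊕ y) · c ≡ x · c xor y · c
·-distribʳ-⊕ [] [] [] = refl
·-distribʳ-⊕ (a ∷ x) (b ∷ y) (e ∷ c) = begin
  ((a xor b) ∧ e) xor (x ⊕ y) · c         ≡⟨ cong₂ _xor_ (∧-distribʳ-xor e a b) (·-distribʳ-⊕ x y c) ⟩
  ((a ∧ e) xor (b ∧ e)) xor (x · c xor y · c) ≡⟨ xor-interchange (a ∧ e) (b ∧ e) (x · c) (y · c) ⟩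
  ((a ∧ e) xor x · c) xor ((b ∧ e) xor y · c) ∎
  where open ≡-Reasoning

·-distribˡ-⊕ : ∀ {s} (y a b : Word s) → y · (a ⊕ b) ≡ y · a xor y · b
·-distribˡ-⊕ y a b = begin
  y · (a ⊕ b)      ≡⟨ ·-comm y (a ⊕ b) ⟩
  (a ⊕ b) · y      ≡⟨ ·-distribʳ-⊕ a b y ⟩
  a · y xor b · y  ≡⟨ cong₂ _xor_ (·-comm a y) (·-comm b y) ⟩
  y · a xor y · b  ∎
  where open ≡-Reasoning

⊕-identityˡ : ∀ {s} (x : Word s) → 0ʷ ⊕ x ≡ x
⊕-identityˡ [] = refl
⊕-identityˡ (a ∷ x) = cong (a ∷_) (⊕-identityˡ x)

⊕-identityʳ : ∀ {s} (x : Word s) → x ⊕ 0ʷ ≡ x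
⊕-identityʳ [] = refl
⊕-identityʳ (a ∷ x) = cong₂ _∷_ (xor-identityʳ a) (⊕-identityʳ x)

⊕-self : ∀ {s} (x : Word s) → x ⊕ x ≡ 0ʷ
⊕-self [] = refl
⊕-self (a ∷ x) = cong₂ _∷_ (xor-same a) (⊕-self x)

xor≡false⇒≡ : ∀ {a b} → a xor b ≡ false → a ≡ b
xor≡false⇒≡ {false} refl = refl
xor≡false⇒≡ {true} {true} _ = refl

⊕≡0ʷ⇒≡ : ∀ {s} {x y : Word s} → x ⊕ y ≡ 0ʷ → x ≡ y
⊕≡0ʷ⇒≡ {x = []} {[]} _ = refl
⊕≡0ʷ⇒≡ {x = a ∷ x} {b ∷ y} eq =
  cong₂ _∷_ (xor≡false⇒≡ (proj₁ (∷-injective eq))) (⊕≡0ʷ⇒≡ (proj₂ (∷-injective eq)))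

≢0ʷ⇒∃·≡true : ∀ {s} {x : Word s} → x ≢ 0ʷ → ∃ λ u → x · u ≡ true
≢0ʷ⇒∃·≡true {x = []} x≢0 = contradiction refl x≢0
≢0ʷ⇒∃·≡true {x = true ∷ x} _ = true ∷ 0ʷ , cong (true xor_) (·-zeroʳ x)
≢0ʷ⇒∃·≡true {x = false ∷ x} x≢0 with ≢0ʷ⇒∃·≡true {x = x} (x≢0 ∘ cong (false ∷_))
... | u , x·u = false ∷ u , x·u

orthogonal⇒0ʷ : ∀ {s} {c : Word s} → (∀ y → y · c ≡ false) → c ≡ 0ʷ
orthogonal⇒0ʷ {c = c} ⊥c with c ≟ʷ 0ʷ
... | yes c≡0 = c≡0
... | no c≢0 with ≢0ʷ⇒∃·≡true c≢0
...   | u , c·u = contradiction (trans (sym c·u) (trans (·-comm c u) (⊥c u))) λ ()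

⟦_⟧ : Bool → ℕ
⟦ b ⟧ = if b then 1 else 0

count : ∀ {n} → (Fin n → Bool) → ℕ
count f = sum (⟦_⟧ ∘ f)

sum-mono-≤ : ∀ {n} {f g : Fin n → ℕ} → (∀ p → f p ≤ g p) → sum f ≤ sum g
sum-mono-≤ {zero} _ = z≤n
sum-mono-≤ {suc n} f≤g = +-mono-≤ (f≤g zero) (sum-mono-≤ (f≤g ∘ suc))

count≤n : ∀ {n} (f : Fin n → Bool) → count f ≤ n
count≤n {zero} f = z≤n
count≤n {suc n} f = +-mono-≤ (⟦⟧≤1 (f zero)) (count≤n (f ∘ suc))
  where
  ⟦⟧≤1 : ∀ b → ⟦ b ⟧ ≤ 1
  ⟦⟧≤1 true = ≤-refl
  ⟦⟧≤1 false = z≤n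

count-witness : ∀ {n} (f : Fin n → Bool) → 0 < count f → ∃ λ p → f p ≡ true
count-witness {suc n} f 0<count with f zero in f0
... | true = zero , f0
... | false with count-witness (f ∘ suc) 0<count
...   | p , fp = suc p , fp

count-remove : ∀ {n} {f : Fin n → Bool} {x} → f x ≡ true →
  count f ≡ suc (count (λ p → not (does (p Fin.≟ x)) ∧ f p))
count-remove {suc n} {f} {zero} fx rewrite fx = refl
count-remove {suc n} {f} {suc x} fx rewrite count-remove {f = f ∘ suc} {x} fx =
  +-suc ⟦ f zero ⟧ _

unique⇒≤count : ∀ {n} {f : Fin n → Bool} {xs} → Unique xs → All (λ p → f p ≡ true) xs →
  length xs ≤ count f
unique⇒≤count [] [] = z≤n
unique⇒≤count {f = f} {x ∷ xs} (x≢xs ∷ unique) (fx ∷ fxs) = begin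
  suc (length xs)
    ≤⟨ s≤s (unique⇒≤count unique (All.zipWith remains (x≢xs , fxs))) ⟩
  suc (count (λ p → not (does (p Fin.≟ x)) ∧ f p))
    ≡⟨ count-remove {f = f} fx ⟨
  count f ∎
  where
  open ≤-Reasoning
  remains : ∀ {y} → x ≢ y × f y ≡ true → not (does (y Fin.≟ x)) ∧ f y ≡ true
  remains {y} (x≢y , fy) rewrite dec-false (y Fin.≟ x) (x≢y ∘ sym) = fy

count-split : ∀ {n} {f g : Fin n → Bool} → (∀ p → f p ≡ true → g p ≡ true) →
  count g ≡ count f + count (λ p → not (f p) ∧ g p)
count-split {f = f} {g} f⊆g = trans (sum-cong-≗ pointwise) (∑-distrib-+ (⟦_⟧ ∘ f) _)
  where
  pointwise : ∀ p → ⟦ g p ⟧ ≡ ⟦ f p ⟧ + ⟦ not (f p) ∧ g p ⟧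
  pointwise p with f p in fp
  ... | true rewrite f⊆g p fp = refl
  ... | false = refl

count-gain : ∀ {n} {f g : Fin n → Bool} {xs} → (∀ p → f p ≡ true → g p ≡ true) → Unique xs →
  All (λ p → f p ≡ false × g p ≡ true) xs → count f + length xs ≤ count g
count-gain {f = f} {g} {xs} f⊆g unique new = begin
  count f + length xs
    ≤⟨ +-monoʳ-≤ (count f) (unique⇒≤count unique (All.map fresh new)) ⟩
  count f + count (λ p → not (f p) ∧ g p)
    ≡⟨ count-split f⊆g ⟨
  count g ∎
  where
  open ≤-Reasoning
  fresh : ∀ {p} → f p ≡ false × g p ≡ true → not (f p) ∧ g p ≡ true
  fresh (fp , gp) rewrite fp = gp

weight : ∀ {s n} → (Fin n → Word s) → Word s → ℕ
weight L y = count (λ p → y · L p)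

zeros : ∀ {s n} → (Fin n → Word s) → ℕ
zeros L = count (isZero ∘ L)

MinWeightAtLeast : ∀ {s n} → (Fin n → Word s) → ℕ → Set
MinWeightAtLeast L d = ∀ y → y ≢ 0ʷ → d ≤ weight L y

-- c lies in the span of a and b, stated dually: whatever is orthogonal to a and b is orthogonal to c.
_∈⟨_,_⟩ : ∀ {s} → Word s → Word s → Word s → Set
c ∈⟨ a , b ⟩ = ∀ y → y · a ≡ false → y · b ≡ false → y · c ≡ false

RecoveryPair : ∀ {s n} → (Fin n → Word s) → Fin n → Set
RecoveryPair L i = ∃₂ λ a b → a ≢ i × b ≢ i × L i ∈⟨ L a , L b ⟩

Locality₂ : ∀ {s n} → (Fin n → Word s) → Set
Locality₂ L = ∀ i → RecoveryPair L i

record LRC (k n d : ℕ) : Set where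
  field
    columns : Fin n → Word k
    minWeight : MinWeightAtLeast columns d
    locality : Locality₂ columns

∈⟨⟩-sym : ∀ {s} {a b c : Word s} → c ∈⟨ a , b ⟩ → c ∈⟨ b , a ⟩
∈⟨⟩-sym c∈ y y·b y·a = c∈ y y·a y·b

∈⟨0ʷ,0ʷ⟩ : ∀ {s} {a b c : Word s} → c ∈⟨ a , b ⟩ → a ≡ 0ʷ → b ≡ 0ʷ → c ≡ 0ʷ
∈⟨0ʷ,0ʷ⟩ c∈ refl refl = orthogonal⇒0ʷ λ y → c∈ y (·-zeroʳ y) (·-zeroʳ y)

≡⇒∈⟨⟩ : ∀ {s} {a b c : Word s} → c ≡ a → c ∈⟨ a , b ⟩
≡⇒∈⟨⟩ refl y y·a _ = y·a

≡⊕⇒∈⟨⟩ : ∀ {s} {a b c : Word s} → c ≡ a ⊕ b → c ∈⟨ a , b ⟩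
≡⊕⇒∈⟨⟩ {a = a} {b} refl y y·a y·b rewrite ·-distribˡ-⊕ y a b | y·a | y·b = refl

∈⟨⟩-agree : ∀ {s} {a b c x y : Word s} → c ∈⟨ a , b ⟩ → x · a ≡ y · a → x · b ≡ y · b → x · c ≡ y · c
∈⟨⟩-agree {a = a} {b} {c} {x} {y} c∈ x·a x·b =
  xor≡false⇒≡ (trans (sym (·-distribʳ-⊕ x y c)) (c∈ (x ⊕ y) (cancels x·a) (cancels x·b)))
  where
  cancels : ∀ {e} → x · e ≡ y · e → (x ⊕ y) · e ≡ false
  cancels {e} x·e rewrite ·-distribʳ-⊕ x y e | x·e = xor-same (y · e)

-- Projection along a column

-- project u identifies F₂^(s+1)/⟨u⟩ with F₂^s by eliminating the first nonzero coordinate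
-- of u; its adjoint embed u maps F₂^s isomorphically onto the orthogonal complement of u.
project : ∀ {s} → Word (suc s) → Word (suc s) → Word s
project (true ∷ u) (c ∷ cs) = if c then cs ⊕ u else cs
project {zero} (false ∷ []) (c ∷ []) = []
project {suc s} (false ∷ u) (c ∷ cs) = c ∷ project u cs

embed : ∀ {s} → Word (suc s) → Word s → Word (suc s)
embed (true ∷ u) y = y · u ∷ y
embed {zero} (false ∷ []) [] = false ∷ []
embed {suc s} (false ∷ u) (y ∷ ys) = y ∷ embed u ys

embed-adjoint : ∀ {s} (u : Word (suc s)) y c → embed u y · c ≡ y · project u c
embed-adjoint (true ∷ u) y (true ∷ cs) = begin
  (y · u ∧ true) xor y · cs  ≡⟨ cong (_xor y · cs) (∧-identityʳ (y · u)) ⟩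
  y · u xor y · cs           ≡⟨ xor-comm (y · u) (y · cs) ⟩
  y · cs xor y · u           ≡⟨ ·-distribˡ-⊕ y cs u ⟨
  y · (cs ⊕ u)               ∎
  where open ≡-Reasoning
embed-adjoint (true ∷ u) y (false ∷ cs) = cong (_xor y · cs) (∧-zeroʳ (y · u))
embed-adjoint {zero} (false ∷ []) [] (c ∷ []) = refl
embed-adjoint {suc s} (false ∷ u) (y ∷ ys) (c ∷ cs) = cong ((y ∧ c) xor_) (embed-adjoint u ys cs)

embed-⊥ : ∀ {s} (u : Word (suc s)) y → embed u y · u ≡ false
embed-⊥ (true ∷ u) y = trans (cong (_xor y · u) (∧-identityʳ (y · u))) (xor-same (y · u))
embed-⊥ {zero} (false ∷ []) [] = refl
embed-⊥ {suc s} (false ∷ u) (y ∷ ys) = trans (cong (_xor embed u ys · u) (∧-zeroʳ y)) (embed-⊥ u ys)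

embed≡0ʷ : ∀ {s} (u : Word (suc s)) {y} → embed u y ≡ 0ʷ → y ≡ 0ʷ
embed≡0ʷ (true ∷ u) eq = proj₂ (∷-injective eq)
embed≡0ʷ {zero} (false ∷ []) {[]} _ = refl
embed≡0ʷ {suc s} (false ∷ u) {y ∷ ys} eq =
  cong₂ _∷_ (proj₁ (∷-injective eq)) (embed≡0ʷ u (proj₂ (∷-injective eq)))

project-self : ∀ {s} (u : Word (suc s)) → project u u ≡ 0ʷ
project-self u = orthogonal⇒0ʷ λ y → trans (sym (embed-adjoint u y u)) (embed-⊥ u y)

project-0ʷ : ∀ {s} (u : Word (suc s)) → project u 0ʷ ≡ 0ʷ
project-0ʷ u = orthogonal⇒0ʷ λ y → trans (sym (embed-adjoint u y 0ʷ)) (·-zeroʳ (embed u y))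

isZero-project : ∀ {s} (u : Word (suc s)) c → isZero c ≡ true → isZero (project u c) ≡ true
isZero-project {s} u c c≡0 rewrite isZero⇒≡0ʷ c c≡0 | project-0ʷ u = isZero-0ʷ {s}

project-kernel : ∀ {s} {u c : Word (suc s)} → u ≢ 0ʷ → project u c ≡ 0ʷ → c ≡ 0ʷ ⊎ c ≡ u
project-kernel {u = true ∷ u} {true ∷ cs} _ eq = inj₂ (cong (true ∷_) (⊕≡0ʷ⇒≡ eq))
project-kernel {u = true ∷ u} {false ∷ cs} _ eq = inj₁ (cong (false ∷_) eq)
project-kernel {zero} {false ∷ []} u≢0 _ = contradiction refl u≢0
project-kernel {suc s} {false ∷ u} {c ∷ cs} u≢0 eq with ∷-injective eq
... | c≡false , eq′ with project-kernel (u≢0 ∘ cong (false ∷_)) eq′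
...   | inj₁ cs≡0 = inj₁ (cong₂ _∷_ c≡false cs≡0)
...   | inj₂ cs≡u = inj₂ (cong₂ _∷_ c≡false cs≡u)

∈⟨⟩-project : ∀ {s} (u : Word (suc s)) {a b c} → c ∈⟨ a , b ⟩ → project u c ∈⟨ project u a , project u b ⟩
∈⟨⟩-project u {a} {b} {c} c∈ y y·a y·b = trans (sym (embed-adjoint u y c))
  (c∈ (embed u y) (trans (embed-adjoint u y a) y·a) (trans (embed-adjoint u y b) y·b))

module _ {s n} (u : Word (suc s)) {L : Fin n → Word (suc s)} where

  weight-project : ∀ y → weight (project u ∘ L) y ≡ weight L (embed u y)
  weight-project y = sum-cong-≗ λ p → cong ⟦_⟧ (sym (embed-adjoint u y (L p)))

  minWeight-project : ∀ {d} → MinWeightAtLeast L d → MinWeightAtLeast (project u ∘ L) d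
  minWeight-project {d} minWeight y y≢0 =
    subst (d ≤_) (sym (weight-project y)) (minWeight (embed u y) (y≢0 ∘ embed≡0ʷ u))

  locality-project : Locality₂ L → Locality₂ (project u ∘ L)
  locality-project locality i with locality i
  ... | a , b , a≢i , b≢i , i∈ = a , b , a≢i , b≢i , ∈⟨⟩-project u i∈

-- The Griesmer bound

griesmer : ℕ → ℕ → ℕ
griesmer zero d = 0
griesmer (suc s) d = d + griesmer s ⌈ d /2⌉

⌈/2⌉-least : ∀ {d r} → d ≤ r + r → ⌈ d /2⌉ ≤ r
⌈/2⌉-least {r = r} d≤2r = ≤-trans (⌈n/2⌉-mono d≤2r) (≤-reflexive (sym (n≡⌈n+n/2⌉ r)))

minimum : ∀ {s} (f : Word s → ℕ) → ∃ λ x → ∀ y → f x ≤ f y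
minimum {zero} f = [] , λ { [] → ≤-refl }
minimum {suc s} f with minimum (f ∘ (true ∷_)) | minimum (f ∘ (false ∷_))
... | x , x-min | x′ , x′-min with ≤-total (f (true ∷ x)) (f (false ∷ x′))
...   | inj₁ fx≤fx′ = true ∷ x , λ { (true ∷ y) → x-min y ; (false ∷ y) → ≤-trans fx≤fx′ (x′-min y) }
...   | inj₂ fx′≤fx = false ∷ x′ , λ { (true ∷ y) → ≤-trans fx′≤fx (x-min y) ; (false ∷ y) → x′-min y }

minimum-nonzero : ∀ {s} (f : Word (suc s) → ℕ) → ∃ λ x → x ≢ 0ʷ × ∀ y → y ≢ 0ʷ → f x ≤ f y
minimum-nonzero {zero} f = true ∷ [] , (λ ()) , λ where
  (true ∷ []) _ → ≤-refl
  (false ∷ []) y≢0 → contradiction refl y≢0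
minimum-nonzero {suc s} f with minimum (f ∘ (true ∷_)) | minimum-nonzero (f ∘ (false ∷_))
... | x , x-min | x′ , x′≢0 , x′-min with ≤-total (f (true ∷ x)) (f (false ∷ x′))
...   | inj₁ fx≤fx′ = true ∷ x , (λ ()) , λ where
  (true ∷ y) _ → x-min y
  (false ∷ y) y≢0 → ≤-trans fx≤fx′ (x′-min y (y≢0 ∘ cong (false ∷_)))
...   | inj₂ fx′≤fx = false ∷ x′ , x′≢0 ∘ (proj₂ ∘ ∷-injective) , λ where
  (true ∷ y) _ → ≤-trans fx′≤fx (x-min y)
  (false ∷ y) y≢0 → x′-min y (y≢0 ∘ cong (false ∷_))

-- The residual code of the codeword of x: the columns outside its support, projected along u.
-- When x · u ≡ true the image of embed u is a complement of ⟨x⟩.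
residual : ∀ {s n} → Word (suc s) → Word (suc s) → (Fin n → Word (suc s)) → Fin n → Word s
residual x u L p = if x · L p then 0ʷ else project u (L p)

module _ {s n} {L : Fin n → Word (suc s)} (x u : Word (suc s)) where

  private
    R = residual x u L

  residual-weight : ∀ y →
    weight L (embed u y) + weight L (embed u y ⊕ x) ≡ weight L x + (weight R y + weight R y)
  residual-weight y = begin
    weight L e + weight L (e ⊕ x)                          ≡⟨ ∑-distrib-+ (⟦_⟧ ∘ (e ·_) ∘ L) _ ⟨
    sum (λ p → ⟦ e · L p ⟧ + ⟦ (e ⊕ x) · L p ⟧)            ≡⟨ sum-cong-≗ pointwise ⟩
    sum (λ p → ⟦ x · L p ⟧ + (⟦ y · R p ⟧ + ⟦ y · R p ⟧))  ≡⟨ ∑-distrib-+ (⟦_⟧ ∘ (x ·_) ∘ L) _ ⟩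
    weight L x + sum (λ p → ⟦ y · R p ⟧ + ⟦ y · R p ⟧)
      ≡⟨ cong (weight L x +_) (∑-distrib-+ (⟦_⟧ ∘ (y ·_) ∘ R) _) ⟩
    weight L x + (weight R y + weight R y)                 ∎
    where
    open ≡-Reasoning
    e = embed u y
    ·-residual : ∀ p → y · R p ≡ not (x · L p) ∧ e · L p
    ·-residual p with x · L p
    ... | true = ·-zeroʳ y
    ... | false = sym (embed-adjoint u y (L p))
    bits : ∀ a b → ⟦ a ⟧ + ⟦ a xor b ⟧ ≡ ⟦ b ⟧ + (⟦ not b ∧ a ⟧ + ⟦ not b ∧ a ⟧)
    bits true true = refl
    bits true false = refl
    bits false true = refl
    bits false false = refl
    pointwise : ∀ p → ⟦ e · L p ⟧ + ⟦ (e ⊕ x) · L p ⟧ ≡ ⟦ x · L p ⟧ + (⟦ y · R p ⟧ + ⟦ y · R p ⟧)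
    pointwise p rewrite ·-distribʳ-⊕ e x (L p) | ·-residual p = bits (e · L p) (x · L p)

  residual-zeros : zeros L + weight L x ≤ zeros R
  residual-zeros = subst (_≤ zeros R) (∑-distrib-+ (⟦_⟧ ∘ isZero ∘ L) _) (sum-mono-≤ pointwise)
    where
    pointwise : ∀ p → ⟦ isZero (L p) ⟧ + ⟦ x · L p ⟧ ≤ ⟦ isZero (R p) ⟧
    pointwise p with x · L p in x·c | isZero (L p) in c≡0
    ... | true | true =
      contradiction (trans (sym x·c) (trans (cong (x ·_) (isZero⇒≡0ʷ (L p) c≡0)) (·-zeroʳ x))) λ ()
    ... | true | false rewrite isZero-0ʷ {s} = ≤-refl
    ... | false | true = ≤-reflexive (cong ⟦_⟧ (sym (isZero-project u (L p) c≡0)))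
    ... | false | false = z≤n

  residual-minWeight : x ≢ 0ʷ → x · u ≡ true → (∀ y → y ≢ 0ʷ → weight L x ≤ weight L y) →
    ∀ {d} → d ≤ weight L x → MinWeightAtLeast R ⌈ d /2⌉
  residual-minWeight x≢0 x·u x-min {d} d≤w y y≢0 =
    ⌈/2⌉-least (≤-trans d≤w (+-cancelˡ-≤ (weight L x) _ _ (begin
      weight L x + weight L x                        ≤⟨ +-mono-≤ (x-min e e≢0) (x-min (e ⊕ x) e⊕x≢0) ⟩
      weight L e + weight L (e ⊕ x)                  ≡⟨ residual-weight y ⟩
      weight L x + (weight R y + weight R y)         ∎)))
    where
    open ≤-Reasoning
    e = embed u y
    e≢0 : e ≢ 0ʷ
    e≢0 = y≢0 ∘ embed≡0ʷ u
    e⊕x≢0 : e ⊕ x ≢ 0ʷ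
    e⊕x≢0 eq = contradiction (trans (sym e⊕x·u) (trans (cong (_· u) eq) (·-zeroˡ u))) λ ()
      where
      e⊕x·u : (e ⊕ x) · u ≡ true
      e⊕x·u = trans (·-distribʳ-⊕ e x u) (cong₂ _xor_ (embed-⊥ u y) x·u)

griesmer-bound : ∀ s {n} {L : Fin n → Word s} {d} → MinWeightAtLeast L d → zeros L + griesmer s d ≤ n
griesmer-bound zero {L = L} _ = ≤-trans (≤-reflexive (+-identityʳ (zeros L))) (count≤n _)
griesmer-bound (suc s) {n} {L} {d} minWeight with minimum-nonzero (weight L)
... | x , x≢0 , x-min with ≢0ʷ⇒∃·≡true x≢0
...   | u , x·u = begin
  zeros L + (d + griesmer s ⌈ d /2⌉)           ≡⟨ +-assoc (zeros L) d _ ⟨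
  zeros L + d + griesmer s ⌈ d /2⌉             ≤⟨ +-monoˡ-≤ _ (+-monoʳ-≤ (zeros L) d≤w) ⟩
  zeros L + weight L x + griesmer s ⌈ d /2⌉    ≤⟨ +-monoˡ-≤ _ (residual-zeros {L = L} x u) ⟩
  zeros (residual x u L) + griesmer s ⌈ d /2⌉  ≤⟨ griesmer-bound s residual-minWeight′ ⟩
  n                                            ∎
  where
  open ≤-Reasoning
  d≤w : d ≤ weight L x
  d≤w = minWeight x x≢0
  residual-minWeight′ : MinWeightAtLeast (residual x u L) ⌈ d /2⌉
  residual-minWeight′ = residual-minWeight {L = L} x u x≢0 x·u x-min d≤w

s≤griesmer : ∀ s {d} → 1 ≤ d → s ≤ griesmer s d
s≤griesmer zero _ = z≤n
s≤griesmer (suc s) {suc d} _ = s≤s (≤-trans (s≤griesmer s (s≤s z≤n)) (m≤n+m _ d))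

⌈double+/2⌉ : ∀ m c → ⌈ (m + m) + c /2⌉ ≡ m + ⌈ c /2⌉
⌈double+/2⌉ zero c = refl
⌈double+/2⌉ (suc m) c = trans (cong (λ x → ⌈ suc x + c /2⌉) (+-suc m m)) (cong suc (⌈double+/2⌉ m c))

griesmer-shift : ∀ s c t → griesmer (suc s) (2 ^ s * t + c) + t ≡ griesmer (suc s) c + 2 ^ suc s * t
griesmer-shift zero c t = base c t
  where
  base : ∀ c t → 1 * t + c + 0 + t ≡ c + 0 + 2 * t
  base = solve-∀
griesmer-shift (suc s) c t = begin
  M + c + griesmer (suc s) ⌈ M + c /2⌉ + t          ≡⟨ cong (λ h → M + c + griesmer (suc s) h + t) halve ⟩
  M + c + griesmer (suc s) (m + ⌈ c /2⌉) + t        ≡⟨ +-assoc (M + c) _ t ⟩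
  M + c + (griesmer (suc s) (m + ⌈ c /2⌉) + t)      ≡⟨ cong (M + c +_) (griesmer-shift s ⌈ c /2⌉ t) ⟩
  M + c + (griesmer (suc s) ⌈ c /2⌉ + M)            ≡⟨ rearrange M c (griesmer (suc s) ⌈ c /2⌉) ⟩
  c + griesmer (suc s) ⌈ c /2⌉ + 2 * M
    ≡⟨ cong (c + griesmer (suc s) ⌈ c /2⌉ +_) (*-assoc 2 (2 ^ suc s) t) ⟨
  griesmer (suc (suc s)) c + 2 ^ suc (suc s) * t    ∎
  where
  open ≡-Reasoning
  m = 2 ^ s * t
  M = 2 ^ suc s * t
  halve : ⌈ M + c /2⌉ ≡ m + ⌈ c /2⌉
  halve = trans (cong (λ x → ⌈ x + c /2⌉) (trans (*-assoc 2 (2 ^ s) t) (cong (m +_) (+-identityʳ m))))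
    (⌈double+/2⌉ m c)
  rearrange : ∀ M c g → M + c + (g + M) ≡ c + g + 2 * M
  rearrange = solve-∀

griesmer₅-shift : ∀ c t → griesmer 5 (c + 16 * t) ≡ griesmer 5 c + 31 * t
griesmer₅-shift c t = +-cancelʳ-≡ t _ _ (begin
  griesmer 5 (c + 16 * t) + t   ≡⟨ cong (λ d → griesmer 5 d + t) (+-comm c (16 * t)) ⟩
  griesmer 5 (16 * t + c) + t   ≡⟨ griesmer-shift 4 c t ⟩
  griesmer 5 c + 32 * t         ≡⟨ cong (griesmer 5 c +_) (+-comm t (31 * t)) ⟩
  griesmer 5 c + (31 * t + t)   ≡⟨ +-assoc (griesmer 5 c) (31 * t) t ⟨
  griesmer 5 c + 31 * t + t     ∎)
  where open ≡-Reasoning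

-- Triangles and the locality bound

zeros-gain : ∀ {s t n} {L : Fin n → Word s} {M : Fin n → Word t} {xs} →
  (∀ p → L p ≡ 0ʷ → M p ≡ 0ʷ) → Unique xs → All (λ p → L p ≢ 0ʷ × M p ≡ 0ʷ) xs →
  zeros L + length xs ≤ zeros M
zeros-gain {L = L} {M} L⊆M unique new = count-gain
  (λ p Lp → dec-true (M p ≟ʷ 0ʷ) (L⊆M p (isZero⇒≡0ʷ (L p) Lp))) unique
  (All.map (λ {p} (Lp≢0 , Mp≡0) → dec-false (L p ≟ʷ 0ʷ) Lp≢0 , dec-true (M p ≟ʷ 0ʷ) Mp≡0) new)

zeros-lower : ∀ {s n} {L : Fin n → Word s} {xs} → Unique xs → All (λ p → L p ≡ 0ʷ) xs → length xs ≤ zeros L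
zeros-lower {L = L} unique vanish = unique⇒≤count unique (All.map (λ {p} → dec-true (L p ≟ʷ 0ʷ)) vanish)

-- Projecting along the left corner and then along the image of the right one kills all three
-- corners while losing only two dimensions.
record Triangle {s n} (L : Fin n → Word (suc (suc s))) : Set where
  field
    apex left right : Fin n
    left≢apex : left ≢ apex
    right≢apex : right ≢ apex
    apex∈⟨left,right⟩ : L apex ∈⟨ L left , L right ⟩
    left≢0ʷ : L left ≢ 0ʷ
    apex-survives : project (L left) (L apex) ≢ 0ʷ

  L₁ : Fin n → Word (suc s)
  L₁ = project (L left) ∘ L

  collapse : Fin n → Word s
  collapse = project (L₁ right) ∘ L₁

  corners : List (Fin n)
  corners = left ∷ right ∷ apex ∷ []

module _ {s n} {L : Fin n → Word (suc (suc s))} (t : Triangle L) where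
  open Triangle t

  right-survives : L₁ right ≢ 0ʷ
  right-survives L₁right≡0 = apex-survives
    (∈⟨0ʷ,0ʷ⟩ (∈⟨⟩-project (L left) apex∈⟨left,right⟩) (project-self (L left)) L₁right≡0)

  left≢right : left ≢ right
  left≢right refl = right-survives (project-self (L left))

  corners-unique : Unique corners
  corners-unique = (left≢right ∷ left≢apex ∷ []) ∷ (right≢apex ∷ []) ∷ [] ∷ []

  collapse-cong : ∀ {p q} → L p ≡ L q → collapse p ≡ collapse q
  collapse-cong = cong (project (L₁ right) ∘ project (L left))

  collapse-0ʷ : ∀ p → L p ≡ 0ʷ → collapse p ≡ 0ʷ
  collapse-0ʷ p Lp≡0 rewrite Lp≡0 | project-0ʷ (L left) = project-0ʷ (L₁ right)

  collapse-∈⟨⟩ : ∀ {a b c} → L c ∈⟨ L a , L b ⟩ → collapse c ∈⟨ collapse a , collapse b ⟩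
  collapse-∈⟨⟩ = ∈⟨⟩-project (L₁ right) ∘ ∈⟨⟩-project (L left)

  collapse-corner : ∀ {p} → p ∈ corners → collapse p ≡ 0ʷ
  collapse-corner (here refl) rewrite project-self (L left) = project-0ʷ (L₁ right)
  collapse-corner (there (here refl)) = project-self (L₁ right)
  collapse-corner (there (there (here refl))) = ∈⟨0ʷ,0ʷ⟩ (collapse-∈⟨⟩ apex∈⟨left,right⟩)
    (collapse-corner (here refl)) (collapse-corner (there (here refl)))

  collapse-gain : zeros L + 3 ≤ zeros collapse
  collapse-gain = zeros-gain collapse-0ʷ corners-unique
    ( (left≢0ʷ , collapse-corner (here refl))
    ∷ (right≢0ʷ , collapse-corner (there (here refl)))
    ∷ (apex≢0ʷ , collapse-corner (there (there (here refl)))) ∷ [])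
    where
    right≢0ʷ : L right ≢ 0ʷ
    right≢0ʷ Lright≡0 = right-survives (trans (cong (project (L left)) Lright≡0) (project-0ʷ (L left)))
    apex≢0ʷ : L apex ≢ 0ʷ
    apex≢0ʷ Lapex≡0 = apex-survives (trans (cong (project (L left)) Lapex≡0) (project-0ʷ (L left)))

  collapse-minWeight : ∀ {d} → MinWeightAtLeast L d → MinWeightAtLeast collapse d
  collapse-minWeight minWeight =
    minWeight-project (L₁ right) {L₁} (minWeight-project (L left) {L} minWeight)

  collapse-locality : Locality₂ L → Locality₂ collapse
  collapse-locality locality =
    locality-project (L₁ right) {L₁} (locality-project (L left) {L} locality)

-- Columns of dimension one leave no room for the two projections of a triangle.
TriangleIn : ∀ {s n} → (Fin n → Word (suc s)) → Set
TriangleIn {zero} L = ⊥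
TriangleIn {suc s} L = Triangle L

data Reduction {s n} (L : Fin n → Word (suc s)) : Set where
  single : ∀ u → zeros L + 2 ≤ zeros (project u ∘ L) → Reduction L
  double : TriangleIn L → Reduction L

reduce-at : ∀ {s n} {L : Fin n → Word (suc s)} {i j k} → j ≢ i → k ≢ i → L i ∈⟨ L j , L k ⟩ →
  L i ≢ 0ʷ → L j ≢ 0ʷ → Reduction L
reduce-at {L = L} {i} {j} j≢i _ _ Li≢0 Lj≢0 with project (L j) (L i) ≟ʷ 0ʷ
... | yes Pi≡0 = single (L j) (zeros-gain (λ p Lp≡0 → trans (cong (project (L j)) Lp≡0) (project-0ʷ (L j)))
        ((j≢i ∷ []) ∷ [] ∷ []) ((Lj≢0 , project-self (L j)) ∷ (Li≢0 , Pi≡0) ∷ []))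
reduce-at {zero} _ _ _ _ _ | no Pi≢0 = contradiction (Word₀≡0ʷ _) Pi≢0
  where
  Word₀≡0ʷ : (x : Word 0) → x ≡ 0ʷ
  Word₀≡0ʷ [] = refl
reduce-at {suc s} {i = i} {j} {k} j≢i k≢i i∈ _ Lj≢0 | no Pi≢0 = double record
  { apex = i ; left = j ; right = k ; left≢apex = j≢i ; right≢apex = k≢i
  ; apex∈⟨left,right⟩ = i∈ ; left≢0ʷ = Lj≢0 ; apex-survives = Pi≢0 }

nonzero-column : ∀ {s n} {L : Fin n → Word (suc s)} {d} → 1 ≤ d → MinWeightAtLeast L d → ∃ λ i → L i ≢ 0ʷ
nonzero-column {s} {L = L} 1≤d minWeight =
  let i , e·Li = count-witness (λ p → e · L p) (≤-trans 1≤d (minWeight e λ ()))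
  in i , λ Li≡0 → contradiction (trans (sym e·Li) (trans (cong (e ·_) Li≡0) (·-zeroʳ e))) λ ()
  where
  e : Word (suc s)
  e = true ∷ 0ʷ

reduce : ∀ {s n} {L : Fin n → Word (suc s)} {d} → 1 ≤ d → MinWeightAtLeast L d → Locality₂ L → Reduction L
reduce {L = L} 1≤d minWeight locality with nonzero-column 1≤d minWeight
... | i , Li≢0 with locality i
...   | a , b , a≢i , b≢i , i∈ with L a ≟ʷ 0ʷ
...     | no La≢0 = reduce-at a≢i b≢i i∈ Li≢0 La≢0
...     | yes La≡0 = reduce-at b≢i a≢i (∈⟨⟩-sym i∈) Li≢0 (Li≢0 ∘ ∈⟨0ʷ,0ʷ⟩ i∈ La≡0)

-- A single projection kills two columns and one dimension, a triangle three columns and two.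
localityBound : ℕ → ℕ → ℕ
localityBound zero d = 0
localityBound (suc zero) d = griesmer 1 d ⊔ 2
localityBound (suc (suc s)) d =
  griesmer (suc (suc s)) d ⊔ ((2 + localityBound (suc s) d) ⊓ (3 + localityBound s d))

module _ (z : ℕ) {n : ℕ} where

  +⊔-bound : ∀ {a b} → z + a ≤ n → z + b ≤ n → z + (a ⊔ b) ≤ n
  +⊔-bound {a} {b} a≤ b≤ = subst (_≤ n) (sym (+-distribˡ-⊔ z a b)) (⊔-lub a≤ b≤)

  gain-then-bound : ∀ {z′ a b} → z + a ≤ z′ → z′ + b ≤ n → z + (a + b) ≤ n
  gain-then-bound {z′} {a} {b} gain bound = begin
    z + (a + b)  ≡⟨ +-assoc z a b ⟨
    z + a + b    ≤⟨ +-monoˡ-≤ b gain ⟩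
    z′ + b       ≤⟨ bound ⟩
    n            ∎
    where open ≤-Reasoning

reduction-bound : ∀ {s n} {L : Fin n → Word (suc (suc s))} {d a b} → Reduction L →
  MinWeightAtLeast L d → Locality₂ L →
  (∀ {L′ : Fin n → Word (suc s)} → MinWeightAtLeast L′ d → Locality₂ L′ → zeros L′ + a ≤ n) →
  (∀ {L′ : Fin n → Word s} → MinWeightAtLeast L′ d → Locality₂ L′ → zeros L′ + b ≤ n) →
  zeros L + ((2 + a) ⊓ (3 + b)) ≤ n
reduction-bound {L = L} (single u gain) minWeight locality bound₁ _ =
  ≤-trans (+-monoʳ-≤ (zeros L) (m⊓n≤m _ _)) (gain-then-bound (zeros L) gain
    (bound₁ (minWeight-project u {L} minWeight) (locality-project u {L} locality)))
reduction-bound {L = L} (double t) minWeight locality _ bound₂ =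
  ≤-trans (+-monoʳ-≤ (zeros L) (m⊓n≤n _ _)) (gain-then-bound (zeros L) (collapse-gain t)
    (bound₂ (collapse-minWeight t minWeight) (collapse-locality t locality)))

locality-bound : ∀ s {n} {L : Fin n → Word s} {d} → 1 ≤ d → MinWeightAtLeast L d → Locality₂ L →
  zeros L + localityBound s d ≤ n
locality-bound zero _ _ _ = ≤-trans (≤-reflexive (+-identityʳ _)) (count≤n _)
locality-bound (suc zero) {L = L} 1≤d minWeight locality =
  +⊔-bound (zeros L) (griesmer-bound 1 minWeight) (reduction-bound₁ (reduce 1≤d minWeight locality))
  where
  reduction-bound₁ : Reduction L → zeros L + 2 ≤ _
  reduction-bound₁ (single u gain) = ≤-trans gain (count≤n _)
  reduction-bound₁ (double ())
locality-bound (suc (suc s)) {L = L} 1≤d minWeight locality =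
  +⊔-bound (zeros L) (griesmer-bound (suc (suc s)) minWeight)
    (reduction-bound (reduce 1≤d minWeight locality) minWeight locality
      (locality-bound (suc s) 1≤d) (locality-bound s 1≤d))

allWords? : ∀ {s} {P : Word s → Set} → (∀ w → Dec (P w)) → Dec (∀ w → P w)
allWords? {zero} P? with P? []
... | yes p = yes λ { [] → p }
... | no ¬p = no λ all → ¬p (all [])
allWords? {suc s} P? with allWords? (P? ∘ (true ∷_)) | allWords? (P? ∘ (false ∷_))
... | yes p | yes q = yes λ { (true ∷ w) → p w ; (false ∷ w) → q w }
... | no ¬p | _ = no λ all → ¬p (all ∘ (true ∷_))
... | yes _ | no ¬q = no λ all → ¬q (all ∘ (false ∷_))

∈⟨_,_⟩? : ∀ {s} (a b c : Word s) → Dec (c ∈⟨ a , b ⟩)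
∈⟨ a , b ⟩? c = allWords? λ y → (y · a Bool.≟ false) →-dec ((y · b Bool.≟ false) →-dec (y · c Bool.≟ false))

fresh : ∀ {n} (xs : List (Fin n)) → length xs < n → ∃ λ w → w ∉ xs
fresh {n} xs len<n with Fin.all? (λ w → Any.any? (w Fin.≟_) xs)
... | no ¬all = Fin.¬∀⟶∃¬ n _ (λ w → Any.any? (w Fin.≟_) xs) ¬all
... | yes all with Fin.pigeonhole len<n (Any.index ∘ all)
...   | i , j , i<j , same = contradiction (begin
  i                             ≡⟨ lookup-index (all i) ⟩
  lookup xs (Any.index (all i)) ≡⟨ cong (lookup xs) same ⟩
  lookup xs (Any.index (all j)) ≡⟨ lookup-index (all j) ⟨
  j                             ∎) (Fin.<⇒≢ i<j)
  where open ≡-Reasoning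

-- Short codes of dimension five contain no triangle

disjoint-sym : ∀ {A : Set} {xs ys : List A} → All (_∉ ys) xs → All (_∉ xs) ys
disjoint-sym h = All.tabulate λ y∈ys y∈xs → All.lookup h y∈xs y∈ys

span : ∀ {s} → Word s → Word s → List (Word s)
span a b = 0ʷ ∷ a ∷ b ∷ a ⊕ b ∷ []

line : ∀ {s} → Word s → Word s → List (Word s)
line p q = p ∷ q ∷ p ⊕ q ∷ []

-- Both facts are decided by exhaustive search; abstract stops the checker from re-running
-- the search wherever they are used.
abstract
  ∈⟨⟩⇒∈span₃ : ∀ (a b c : Word 3) → c ∈⟨ a , b ⟩ → c ∈ span a b
  ∈⟨⟩⇒∈span₃ = toWitness {a? = allWords? λ a → allWords? λ b → allWords? λ c →
    ∈⟨ a , b ⟩? c →-dec Any.any? (c ≟ʷ_) (span a b)} _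

  lines-meet : ∀ (p q u v : Word 3) → p ≢ 0ʷ → q ≢ 0ʷ → p ≢ q → u ≢ 0ʷ → v ≢ 0ʷ → u ≢ v →
    Any (_∈ line u v) (line p q)
  lines-meet = toWitness {a? = allWords? λ p → allWords? λ q → allWords? λ u → allWords? λ v →
    ¬? (p ≟ʷ 0ʷ) →-dec (¬? (q ≟ʷ 0ʷ) →-dec (¬? (p ≟ʷ q) →-dec
    (¬? (u ≟ʷ 0ʷ) →-dec (¬? (v ≟ʷ 0ʷ) →-dec (¬? (u ≟ʷ v) →-dec
    Any.any? (λ a → Any.any? (a ≟ʷ_) (line u v)) (line p q))))))} _

module ShortCode {n} {L : Fin n → Word 5} {d} (minWeight : MinWeightAtLeast L d) (locality : Locality₂ L)
  (short₃ : n < 4 + griesmer 3 d) (short₂ : n < 5 + griesmer 2 d) where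

  module _ (t : Triangle L) where
    open Triangle t

    outside-nonzero : ∀ {p} → p ∉ corners → collapse p ≢ 0ʷ
    outside-nonzero {p} p∉ Cp≡0 = <⇒≱ short₃ (begin
      4 + griesmer 3 d               ≤⟨ +-monoˡ-≤ _ (zeros-lower {L = collapse} unique vanish) ⟩
      zeros collapse + griesmer 3 d  ≤⟨ griesmer-bound 3 (collapse-minWeight t minWeight) ⟩
      n                              ∎)
      where
      open ≤-Reasoning
      unique : Unique (p ∷ corners)
      unique = ¬Any⇒All¬ corners p∉ ∷ corners-unique t
      vanish : All (λ r → collapse r ≡ 0ʷ) (p ∷ corners)
      vanish = Cp≡0 ∷ All.tabulate (collapse-corner t)

    outside-injective : ∀ {p q} → p ∉ corners → q ∉ corners → p ≢ q → collapse p ≢ collapse q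
    outside-injective {p} {q} p∉ q∉ p≢q Cp≡Cq = <⇒≱ short₂ (begin
      5 + griesmer 2 d         ≤⟨ +-monoˡ-≤ _ (zeros-lower {L = C′} unique vanish) ⟩
      zeros C′ + griesmer 2 d  ≤⟨ griesmer-bound 2 (minWeight-project (collapse p) {collapse} minWeight′) ⟩
      n                        ∎)
      where
      open ≤-Reasoning
      C′ = project (collapse p) ∘ collapse
      minWeight′ = collapse-minWeight t minWeight
      unique : Unique (p ∷ q ∷ corners)
      unique = (p≢q ∷ ¬Any⇒All¬ corners p∉) ∷ ¬Any⇒All¬ corners q∉ ∷ corners-unique t
      vanish : All (λ r → C′ r ≡ 0ʷ) (p ∷ q ∷ corners)
      vanish = project-self (collapse p)
             ∷ trans (cong (project (collapse p)) (sym Cp≡Cq)) (project-self (collapse p))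
             ∷ All.tabulate λ r∈ →
                 trans (cong (project (collapse p)) (collapse-corner t r∈)) (project-0ʷ (collapse p))

    isolated : ∀ {p q} → p ∉ corners → q ≢ p → collapse q ≢ collapse p
    isolated {p} {q} p∉ q≢p with Any.any? (q Fin.≟_) corners
    ... | yes q∈ = λ Cq≡Cp → outside-nonzero p∉ (trans (sym Cq≡Cp) (collapse-corner t q∈))
    ... | no q∉ = outside-injective q∉ p∉ q≢p

    line-through : ∀ {r a b} → r ∉ corners → a ≢ r → b ≢ r → L r ∈⟨ L a , L b ⟩ →
      a ∉ corners × b ∉ corners × a ≢ b × collapse r ≡ collapse a ⊕ collapse b
    line-through {r} {a} {b} r∉ a≢r b≢r r∈ with ∈⟨⟩⇒∈span₃ _ _ _ (collapse-∈⟨⟩ t r∈)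
    ... | here Cr≡0 = contradiction Cr≡0 (outside-nonzero r∉)
    ... | there (here Cr≡Ca) = contradiction (sym Cr≡Ca) (isolated r∉ a≢r)
    ... | there (there (here Cr≡Cb)) = contradiction (sym Cr≡Cb) (isolated r∉ b≢r)
    ... | there (there (there (here Cr≡Ca⊕Cb))) = a∉ , b∉ , a≢b , Cr≡Ca⊕Cb
      where
      a∉ : a ∉ corners
      a∉ a∈ = isolated r∉ b≢r (sym (trans Cr≡Ca⊕Cb
        (trans (cong (_⊕ collapse b) (collapse-corner t a∈)) (⊕-identityˡ (collapse b)))))
      b∉ : b ∉ corners
      b∉ b∈ = isolated r∉ a≢r (sym (trans Cr≡Ca⊕Cb
        (trans (cong (collapse a ⊕_) (collapse-corner t b∈)) (⊕-identityʳ (collapse a)))))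
      a≢b : a ≢ b
      a≢b refl = outside-nonzero r∉ (trans Cr≡Ca⊕Cb (⊕-self (collapse a)))

    second-triangle : ∀ {r} → r ∉ corners → Σ (Triangle L) λ t′ → All (_∉ corners) (Triangle.corners t′)
    second-triangle {r} r∉ with locality r
    ... | a , b , a≢r , b≢r , r∈ with line-through r∉ a≢r b≢r r∈
    ...   | a∉ , b∉ , _ , _ = t′ , a∉ ∷ b∉ ∷ r∉ ∷ []
      where
      La≢0 : L a ≢ 0ʷ
      La≢0 = outside-nonzero a∉ ∘ collapse-0ʷ t a
      t′ : Triangle L
      t′ = record
        { apex = r ; left = a ; right = b ; left≢apex = a≢r ; right≢apex = b≢r
        ; apex∈⟨left,right⟩ = r∈ ; left≢0ʷ = La≢0
        ; apex-survives = λ P≡0 → case-kernel (project-kernel La≢0 P≡0) }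
        where
        case-kernel : L r ≡ 0ʷ ⊎ L r ≡ L a → ⊥
        case-kernel (inj₁ Lr≡0) = outside-nonzero r∉ (collapse-0ʷ t r Lr≡0)
        case-kernel (inj₂ Lr≡La) = isolated r∉ a≢r (sym (collapse-cong t Lr≡La))

    disjoint-lines : ∀ {j k i x y w} →
      All (_∉ corners) (j ∷ k ∷ i ∷ []) → All (_∉ corners) (x ∷ y ∷ w ∷ []) →
      All (_∉ j ∷ k ∷ i ∷ []) (x ∷ y ∷ w ∷ []) → j ≢ k → x ≢ y →
      collapse i ≡ collapse j ⊕ collapse k → collapse w ≡ collapse x ⊕ collapse y → ⊥
    disjoint-lines {j} {k} {i} {x} {y} {w} out₁@(j∉ ∷ k∉ ∷ _) out₂@(x∉ ∷ y∉ ∷ _) apart j≢k x≢y Ci Cw =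
      collision (find meet′)
      where
      meet : Any (_∈ line (collapse x) (collapse y)) (line (collapse j) (collapse k))
      meet = lines-meet (collapse j) (collapse k) (collapse x) (collapse y)
               (outside-nonzero j∉) (outside-nonzero k∉) (outside-injective j∉ k∉ j≢k)
               (outside-nonzero x∉) (outside-nonzero y∉) (outside-injective x∉ y∉ x≢y)
      meet′ : Any (λ α → collapse α ∈ map collapse (x ∷ y ∷ w ∷ [])) (j ∷ k ∷ i ∷ [])
      meet′ = map⁻ (subst₂ (λ ℓ ℓ′ → Any (_∈ ℓ′) ℓ)
             (cong (λ c → collapse j ∷ collapse k ∷ c ∷ []) (sym Ci))
             (cong (λ c → collapse x ∷ collapse y ∷ c ∷ []) (sym Cw)) meet)
      collision : (∃ λ α → α ∈ j ∷ k ∷ i ∷ [] × collapse α ∈ map collapse (x ∷ y ∷ w ∷ [])) → ⊥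
      collision (α , α∈ , Cα∈) with ∈-map⁻ collapse Cα∈
      ... | β , β∈ , Cα≡Cβ = outside-injective (All.lookup out₁ α∈) (All.lookup out₂ β∈)
            (λ α≡β → All.lookup apart β∈ (subst (_∈ _) α≡β α∈)) Cα≡Cβ

  two-triangles : (t t′ : Triangle L) → All (_∉ Triangle.corners t′) (Triangle.corners t) →
    ∀ {w} → w ∉ Triangle.corners t → w ∉ Triangle.corners t′ → ⊥
  two-triangles t t′ (_ ∷ _ ∷ apex∉t′ ∷ []) {w} w∉t w∉t′ with locality w
  ... | x , y , x≢w , y≢w , w∈ with line-through t w∉t x≢w y≢w w∈ | line-through t′ w∉t′ x≢w y≢w w∈
                                  | line-through t′ apex∉t′ left≢apex right≢apex apex∈⟨left,right⟩
    where open Triangle t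
  ... | x∉t , y∉t , _ , _ | x∉t′ , y∉t′ , x≢y , Dw | j∉t′ , k∉t′ , j≢k , Di = disjoint-lines t′
    (j∉t′ ∷ k∉t′ ∷ apex∉t′ ∷ []) (x∉t′ ∷ y∉t′ ∷ w∉t′ ∷ []) (x∉t ∷ y∉t ∷ w∉t ∷ []) j≢k x≢y Di Dw

  no-triangle : 6 < n → Triangle L → ⊥
  no-triangle 6<n t with fresh (Triangle.corners t) (≤-trans (m≤m+n 4 3) 6<n)
  ... | r , r∉t with second-triangle t r∉t
  ...   | t′ , disjoint with fresh (Triangle.corners t ++ˡ Triangle.corners t′) 6<n
  ...     | w , w∉ =
    two-triangles t t′ (disjoint-sym disjoint) (w∉ ∘ ∈-++⁺ˡ) (w∉ ∘ ∈-++⁺ʳ (Triangle.corners t))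

shortBound : ℕ → ℕ
shortBound d = (4 + griesmer 3 d) ⊓ (5 + griesmer 2 d) ⊓ (2 + localityBound 4 d)

short-code-bound : ∀ {n} {L : Fin n → Word 5} {d} → 3 ≤ d → MinWeightAtLeast L d → Locality₂ L →
  shortBound d ≤ n
short-code-bound {n} {L} {d} 3≤d minWeight locality with reduce (≤-trans (s≤s z≤n) 3≤d) minWeight locality
... | single u gain = ≤-trans (m⊓n≤n _ _) (m+n≤o⇒n≤o (zeros L) (gain-then-bound (zeros L) gain
      (locality-bound 4 (≤-trans (s≤s z≤n) 3≤d)
        (minWeight-project u {L} minWeight) (locality-project u {L} locality))))
... | double t with 4 + griesmer 3 d ≤? n | 5 + griesmer 2 d ≤? n
...   | yes ≤n | _ = ≤-trans (m⊓n≤m _ _) (≤-trans (m⊓n≤m _ _) ≤n)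
...   | no _ | yes ≤n = ≤-trans (m⊓n≤m _ _) (≤-trans (m⊓n≤n _ _) ≤n)
...   | no ≰n₃ | no ≰n₂ = ⊥-elim (ShortCode.no-triangle minWeight locality (≰⇒> ≰n₃) (≰⇒> ≰n₂) 6<n t)
  where
  6<n : 6 < n
  6<n = ≤-trans (+-mono-≤ 3≤d (s≤griesmer 4 (≤-trans (s≤s z≤n) (⌈n/2⌉-mono 3≤d))))
    (m+n≤o⇒n≤o (zeros L) (griesmer-bound 5 minWeight))

column : ∀ {k n} → GenMat k n → Fin n → Word k
column G p = Vec.map (λ row → Vec.lookup row p) G

fromColumns : ∀ {k n} → (Fin n → Word k) → GenMat k n
fromColumns L = Vec.tabulate λ r → Vec.tabulate λ p → Vec.lookup (L p) r

column-fromColumns : ∀ {k n} (L : Fin n → Word k) p → column (fromColumns L) p ≡ L p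
column-fromColumns L p = begin
  Vec.map (λ row → Vec.lookup row p) (Vec.tabulate λ r → Vec.tabulate λ q → Vec.lookup (L q) r)
    ≡⟨ tabulate-∘ (λ row → Vec.lookup row p) _ ⟨
  Vec.tabulate (λ r → Vec.lookup (Vec.tabulate λ q → Vec.lookup (L q) r) p)
    ≡⟨ tabulate-cong (λ r → lookup∘tabulate (λ q → Vec.lookup (L q) r) p) ⟩
  Vec.tabulate (Vec.lookup (L p))
    ≡⟨ tabulate∘lookup (L p) ⟩
  L p ∎
  where open ≡-Reasoning

lookup-encode : ∀ {k n} (G : GenMat k n) x p → Vec.lookup (encode G x) p ≡ x · column G p
lookup-encode [] [] p = lookup-replicate p false
lookup-encode (g ∷ G) (b ∷ x) p =
  trans (lookup-zipWith _xor_ p (if b then g else replicate _ false) (encode G x))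
    (cong₂ _xor_ (lookup-row b) (lookup-encode G x p))
  where
  lookup-row : ∀ b → Vec.lookup (if b then g else replicate _ false) p ≡ b ∧ Vec.lookup g p
  lookup-row true = refl
  lookup-row false = lookup-replicate p false

dist-count : ∀ {n} (u v : Word n) → dist u v ≡ count (λ p → Vec.lookup u p xor Vec.lookup v p)
dist-count [] [] = refl
dist-count (a ∷ u) (b ∷ v) = cong (⟦ a xor b ⟧ +_) (dist-count u v)

dist-encode : ∀ {k n} (G : GenMat k n) x y → dist (encode G x) (encode G y) ≡ weight (column G) (x ⊕ y)
dist-encode G x y = trans (dist-count (encode G x) (encode G y)) (sum-cong-≗ λ p → cong ⟦_⟧ (begin
  Vec.lookup (encode G x) p xor Vec.lookup (encode G y) p
    ≡⟨ cong₂ _xor_ (lookup-encode G x p) (lookup-encode G y p) ⟩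
  x · column G p xor y · column G p
    ≡⟨ ·-distribʳ-⊕ x y (column G p) ⟨
  (x ⊕ y) · column G p ∎))
  where open ≡-Reasoning

dist-self : ∀ {n} (u : Word n) → dist u u ≡ 0
dist-self [] = refl
dist-self (a ∷ u) rewrite xor-same a = dist-self u

minWeight-columns : ∀ {k n} {G : GenMat k n} {d} → IsDimK G → MinDistAtLeast G d →
  MinWeightAtLeast (column G) d
minWeight-columns {G = G} {d} injective minDist y y≢0 =
  subst (d ≤_) (trans (dist-encode G y 0ʷ) (cong (weight (column G)) (⊕-identityʳ y)))
    (minDist y 0ʷ (y≢0 ∘ injective y 0ʷ))

cover₂ : ∀ {n} {S : Subset n} {i a₀} → i ∉ₛ S → a₀ ≢ i → ∣ S ∣ ≤ 2 →
  ∃₂ λ a b → a ≢ i × b ≢ i × ∀ {l} → l ∈ₛ S → l ≡ a ⊎ l ≡ b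
cover₂ {S = S} {i} {a₀} i∉S a₀≢i ∣S∣≤2 with Fin.any? (_∈ₛ? S)
... | no ∄ = a₀ , a₀ , a₀≢i , a₀≢i , λ {l} l∈S → contradiction (l , l∈S) ∄
... | yes (a , a∈S) with Fin.any? (_∈ₛ? S - a)
...   | no ∄ = a , a , ∉⇒≢ a∈S , ∉⇒≢ a∈S , λ {l} l∈S → inj₁ (only l∈S)
  where
  ∉⇒≢ : ∀ {x} → x ∈ₛ S → x ≢ i
  ∉⇒≢ x∈S refl = i∉S x∈S
  only : ∀ {l} → l ∈ₛ S → l ≡ a
  only {l} l∈S with l Fin.≟ a
  ... | yes l≡a = l≡a
  ... | no l≢a = contradiction (l , x∈p∧x≢y⇒x∈p-y l∈S l≢a) ∄
...   | yes (b , b∈S-a) = a , b , ∉⇒≢ a∈S , ∉⇒≢ (p─q⊆p S ⁅ a ⁆ b∈S-a) , λ {l} l∈S → two l∈S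
  where
  ∉⇒≢ : ∀ {x} → x ∈ₛ S → x ≢ i
  ∉⇒≢ x∈S refl = i∉S x∈S
  two : ∀ {l} → l ∈ₛ S → l ≡ a ⊎ l ≡ b
  two {l} l∈S with l Fin.≟ a | l Fin.≟ b
  ... | yes l≡a | _ = inj₁ l≡a
  ... | no _ | yes l≡b = inj₂ l≡b
  ... | no l≢a | no l≢b = contradiction ∣S∣≤2 (<⇒≱ 2<∣S∣)
    where
    0<∣S-a-b∣ : 0 < ∣ S - a - b ∣
    0<∣S-a-b∣ = ≤-trans (s≤s z≤n) (x∈p⇒∣p-x∣<∣p∣ (x∈p∧x≢y⇒x∈p-y (x∈p∧x≢y⇒x∈p-y l∈S l≢a) l≢b))
    2<∣S∣ : 2 < ∣ S ∣
    2<∣S∣ = ≤-trans (s≤s (≤-trans (s≤s 0<∣S-a-b∣) (x∈p⇒∣p-x∣<∣p∣ b∈S-a))) (x∈p⇒∣p-x∣<∣p∣ a∈S)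

locality-columns : ∀ {k n} {G : GenMat k n} → 2 ≤ n → HasLocality G 2 → Locality₂ (column G)
locality-columns {G = G} 2≤n hasLocality i with hasLocality i | fresh (i ∷ []) 2≤n
... | S , i∉S , ∣S∣≤2 , recovers | a₀ , a₀∉ with cover₂ i∉S (a₀∉ ∘ here) ∣S∣≤2
...   | a , b , a≢i , b≢i , covers = a , b , a≢i , b≢i , i∈
  where
  vanishes₀ : ∀ j → Vec.lookup (encode G 0ʷ) j ≡ false
  vanishes₀ j = trans (lookup-encode G 0ʷ j) (·-zeroˡ (column G j))
  vanishes : ∀ {y j} → y · column G a ≡ false → y · column G b ≡ false → j ≡ a ⊎ j ≡ b →
    Vec.lookup (encode G y) j ≡ false
  vanishes {y} {j} y·a _ (inj₁ refl) = trans (lookup-encode G y j) y·a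
  vanishes {y} {j} _ y·b (inj₂ refl) = trans (lookup-encode G y j) y·b
  i∈ : column G i ∈⟨ column G a , column G b ⟩
  i∈ y y·a y·b = begin
    y · column G i
      ≡⟨ lookup-encode G y i ⟨
    Vec.lookup (encode G y) i
      ≡⟨ recovers y 0ʷ (λ j j∈S → trans (vanishes y·a y·b (covers j∈S)) (sym (vanishes₀ j))) ⟩
    Vec.lookup (encode G 0ʷ) i
      ≡⟨ vanishes₀ i ⟩
    false ∎
    where open ≡-Reasoning

∣p∪q∣≤∣p∣+∣q∣ : ∀ {n} (p q : Subset n) → ∣ p ∪ q ∣ ≤ ∣ p ∣ + ∣ q ∣
∣p∪q∣≤∣p∣+∣q∣ [] [] = z≤n
∣p∪q∣≤∣p∣+∣q∣ (true ∷ p) (x ∷ q) = s≤s (≤-trans (∣p∪q∣≤∣p∣+∣q∣ p q) (+-monoʳ-≤ ∣ p ∣ (∣p∣≤∣x∷p∣ x q)))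
∣p∪q∣≤∣p∣+∣q∣ (false ∷ p) (true ∷ q) =
  ≤-trans (s≤s (∣p∪q∣≤∣p∣+∣q∣ p q)) (≤-reflexive (sym (+-suc ∣ p ∣ ∣ q ∣)))
∣p∪q∣≤∣p∣+∣q∣ (false ∷ p) (false ∷ q) = ∣p∪q∣≤∣p∣+∣q∣ p q

lookup-fromColumns : ∀ {k n} (L : Fin n → Word k) x p → Vec.lookup (encode (fromColumns L) x) p ≡ x · L p
lookup-fromColumns L x p = trans (lookup-encode (fromColumns L) x p) (cong (x ·_) (column-fromColumns L p))

dist-fromColumns : ∀ {k n} (L : Fin n → Word k) x y →
  dist (encode (fromColumns L) x) (encode (fromColumns L) y) ≡ weight L (x ⊕ y)
dist-fromColumns L x y = trans (dist-encode (fromColumns L) x y)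
  (sum-cong-≗ λ p → cong (⟦_⟧ ∘ ((x ⊕ y) ·_)) (column-fromColumns L p))

locality-fromColumns : ∀ {k n} {L : Fin n → Word k} → Locality₂ L → HasLocality (fromColumns L) 2
locality-fromColumns {L = L} locality i with locality i
... | a , b , a≢i , b≢i , i∈ = ⁅ a ⁆ ∪ ⁅ b ⁆ , i∉S , ∣S∣≤2 , agree
  where
  G = fromColumns L
  ∣S∣≤2 : ∣ ⁅ a ⁆ ∪ ⁅ b ⁆ ∣ ≤ 2
  ∣S∣≤2 = ≤-trans (∣p∪q∣≤∣p∣+∣q∣ ⁅ a ⁆ ⁅ b ⁆) (≤-reflexive (cong₂ _+_ (∣⁅x⁆∣≡1 a) (∣⁅x⁆∣≡1 b)))
  i∉S : i ∉ₛ ⁅ a ⁆ ∪ ⁅ b ⁆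
  i∉S i∈S with x∈p∪q⁻ ⁅ a ⁆ ⁅ b ⁆ i∈S
  ... | inj₁ i∈a = a≢i (sym (x∈⁅y⁆⇒x≡y a i∈a))
  ... | inj₂ i∈b = b≢i (sym (x∈⁅y⁆⇒x≡y b i∈b))
  agree : ∀ x y → (∀ j → j ∈ₛ ⁅ a ⁆ ∪ ⁅ b ⁆ → Vec.lookup (encode G x) j ≡ Vec.lookup (encode G y) j) →
    Vec.lookup (encode G x) i ≡ Vec.lookup (encode G y) i
  agree x y same = begin
    Vec.lookup (encode G x) i  ≡⟨ lookup-fromColumns L x i ⟩
    x · L i                    ≡⟨ ∈⟨⟩-agree {x = x} {y} i∈ (agree-at (inj₁ (x∈⁅x⁆ a)))
                                                            (agree-at (inj₂ (x∈⁅x⁆ b))) ⟩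
    y · L i                    ≡⟨ lookup-fromColumns L y i ⟨
    Vec.lookup (encode G y) i  ∎
    where
    open ≡-Reasoning
    agree-at : ∀ {j} → j ∈ₛ ⁅ a ⁆ ⊎ j ∈ₛ ⁅ b ⁆ → x · L j ≡ y · L j
    agree-at {j} j∈ = begin
      x · L j                    ≡⟨ lookup-fromColumns L x j ⟨
      Vec.lookup (encode G x) j  ≡⟨ same j (x∈p∪q⁺ j∈) ⟩
      Vec.lookup (encode G y) j  ≡⟨ lookup-fromColumns L y j ⟩
      y · L j                    ∎

LRC⇒hasCode : ∀ {k n d} → 1 ≤ d → LRC k n d → HasCode n k d 2
LRC⇒hasCode {d = d} 1≤d C = G , injective , minDist , locality-fromColumns locality
  where
  open LRC C renaming (columns to L)
  G = fromColumns L
  minDist : MinDistAtLeast G d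
  minDist x y Gx≢Gy =
    subst (d ≤_) (sym (dist-fromColumns L x y)) (minWeight (x ⊕ y) (Gx≢Gy ∘ cong (encode G) ∘ ⊕≡0ʷ⇒≡))
  injective : IsDimK G
  injective x y Gx≡Gy with x ≟ʷ y
  ... | yes x≡y = x≡y
  ... | no x≢y = contradiction (begin
    1                                    ≤⟨ 1≤d ⟩
    d                                    ≤⟨ minWeight (x ⊕ y) (x≢y ∘ ⊕≡0ʷ⇒≡) ⟩
    weight L (x ⊕ y)                     ≡⟨ dist-fromColumns L x y ⟨
    dist (encode G x) (encode G y)       ≡⟨ cong (λ u → dist u (encode G y)) Gx≡Gy ⟩
    dist (encode G y) (encode G y)       ≡⟨ dist-self (encode G y) ⟩
    0                                    ∎) λ ()
    where open ≤-Reasoning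

griesmer-lower : ∀ {n k d r} → HasCode n k d r → griesmer k d ≤ n
griesmer-lower {k = k} (G , injective , minDist , _) =
  m+n≤o⇒n≤o (zeros (column G)) (griesmer-bound k (minWeight-columns {G = G} injective minDist))

hasCode⇒LRC : ∀ {n k d} → 1 ≤ d → 2 ≤ k → HasCode n k d 2 → LRC k n d
hasCode⇒LRC {k = k} 1≤d 2≤k code@(G , injective , minDist , hasLocality) = record
  { columns = column G
  ; minWeight = minWeight-columns {G = G} injective minDist
  ; locality = locality-columns {G = G} 2≤n hasLocality }
  where
  2≤n = ≤-trans 2≤k (≤-trans (s≤griesmer k 1≤d) (griesmer-lower code))

locality-lower : ∀ {n k d} → 1 ≤ d → 2 ≤ k → HasCode n k d 2 → localityBound k d ≤ n
locality-lower {k = k} 1≤d 2≤k code =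
  m+n≤o⇒n≤o (zeros C.columns) (locality-bound k 1≤d C.minWeight C.locality)
  where module C = LRC (hasCode⇒LRC 1≤d 2≤k code)

short-lower : ∀ {n d} → 3 ≤ d → HasCode n 5 d 2 → shortBound d ≤ n
short-lower 3≤d code = short-code-bound 3≤d C.minWeight C.locality
  where module C = LRC (hasCode⇒LRC (≤-trans (s≤s z≤n) 3≤d) (s≤s (s≤s z≤n)) code)

-- Juxtaposition of codes

sum-++ : ∀ {m n} (f : Fin m → ℕ) (g : Fin n → ℕ) → sum (f ++ g) ≡ sum f + sum g
sum-++ {zero} f g = refl
sum-++ {suc m} f g = begin
  f zero + sum ((f ++ g) ∘ suc)     ≡⟨ cong (f zero +_) (sum-cong-≗ ([,]-map ∘ splitAt m)) ⟩
  f zero + sum ((f ∘ suc) ++ g)     ≡⟨ cong (f zero +_) (sum-++ (f ∘ suc) g) ⟩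
  f zero + (sum (f ∘ suc) + sum g)  ≡⟨ +-assoc (f zero) _ _ ⟨
  sum f + sum g                     ∎
  where open ≡-Reasoning

weight-++ : ∀ {k m n} (L : Fin m → Word k) (M : Fin n → Word k) y →
  weight (L ++ M) y ≡ weight L y + weight M y
weight-++ {m = m} L M y =
  trans (sum-cong-≗ ([,]-∘ (⟦_⟧ ∘ (y ·_)) ∘ splitAt m)) (sum-++ (⟦_⟧ ∘ (y ·_) ∘ L) (⟦_⟧ ∘ (y ·_) ∘ M))

recoveryPair-embed : ∀ {k m N} {L : Fin m → Word k} {K : Fin N → Word k} (e : Fin m → Fin N) →
  (∀ {a b} → e a ≡ e b → a ≡ b) → (∀ p → K (e p) ≡ L p) → ∀ {i} → RecoveryPair L i → RecoveryPair K (e i)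
recoveryPair-embed {L = L} {K} e e-injective K∘e≗L {i} (a , b , a≢i , b≢i , i∈) =
  e a , e b , a≢i ∘ e-injective , b≢i ∘ e-injective , λ y y·a y·b → begin
    y · K (e i)   ≡⟨ cong (y ·_) (K∘e≗L i) ⟩
    y · L i       ≡⟨ i∈ y (trans (cong (y ·_) (sym (K∘e≗L a))) y·a)
                          (trans (cong (y ·_) (sym (K∘e≗L b))) y·b) ⟩
    false         ∎
  where open ≡-Reasoning

locality-++ : ∀ {k m n} {L : Fin m → Word k} {M : Fin n → Word k} →
  Locality₂ L → Locality₂ M → Locality₂ (L ++ M)
locality-++ {m = m} {n} {L} {M} locL locM i = by-side (splitAt m i) refl
  where
  by-side : ∀ side → splitAt m i ≡ side → RecoveryPair (L ++ M) i
  by-side (inj₁ j) split = subst (RecoveryPair (L ++ M)) (Fin.splitAt⁻¹-↑ˡ split)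
    (recoveryPair-embed (_↑ˡ n) (Fin.↑ˡ-injective n _ _) (lookup-++ˡ L M) (locL j))
  by-side (inj₂ j) split = subst (RecoveryPair (L ++ M)) (Fin.splitAt⁻¹-↑ʳ split)
    (recoveryPair-embed (m ↑ʳ_) (Fin.↑ʳ-injective m _ _) (lookup-++ʳ L M) (locM j))

infixr 5 _⊞_
_⊞_ : ∀ {k m n d e} → LRC k m d → LRC k n e → LRC k (m + n) (d + e)
_⊞_ {d = d} {e} C D = record
  { columns = C.columns ++ D.columns
  ; minWeight = λ y y≢0 → subst (d + e ≤_) (sym (weight-++ C.columns D.columns y))
      (+-mono-≤ (C.minWeight y y≢0) (D.minWeight y y≢0))
  ; locality = locality-++ C.locality D.locality }
  where
  module C = LRC C
  module D = LRC D

repeat : ∀ {k n d} → LRC k n d → ∀ t → LRC k (t * n) (t * d)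
repeat C zero = record { columns = λ () ; minWeight = λ _ _ → z≤n ; locality = λ () }
repeat C (suc t) = C ⊞ repeat C t

-- Explicit codes

-- A column is written as a number, read in binary with the least significant bit first.
binary : ∀ s → ℕ → Word s
binary zero _ = []
binary (suc s) k = (k % 2 ≡ᵇ 1) ∷ binary s ⌊ k /2⌋

columnsOf : ∀ {n} → Vec ℕ n → Fin n → Word 5
columnsOf v = binary 5 ∘ Vec.lookup v

Repair : ∀ {k n} → (Fin n → Word k) → Fin n → Set
Repair L i = ∃₂ λ a b → a ≢ i × b ≢ i × (L i ≡ L a ⊎ L i ≡ L a ⊕ L b)

repair? : ∀ {k n} (L : Fin n → Word k) i → Dec (Repair L i)
repair? L i = Fin.any? λ a → Fin.any? λ b →
  ¬? (a Fin.≟ i) ×-dec ¬? (b Fin.≟ i) ×-dec (L i ≟ʷ L a ⊎-dec L i ≟ʷ L a ⊕ L b)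

repair⇒recoveryPair : ∀ {k n} {L : Fin n → Word k} {i} → Repair L i → RecoveryPair L i
repair⇒recoveryPair (a , b , a≢i , b≢i , inj₁ copy) = a , b , a≢i , b≢i , ≡⇒∈⟨⟩ copy
repair⇒recoveryPair (a , b , a≢i , b≢i , inj₂ sum) = a , b , a≢i , b≢i , ≡⊕⇒∈⟨⟩ sum

minWeight? : ∀ {k n} (L : Fin n → Word k) d → Dec (MinWeightAtLeast L d)
minWeight? L d = allWords? λ y → ¬? (y ≟ʷ 0ʷ) →-dec (d ≤? weight L y)

explicit : ∀ {n} (v : Vec ℕ n) d →
  {True (minWeight? (columnsOf v) d)} → {True (Fin.all? (repair? (columnsOf v)))} → LRC 5 n d
explicit v d {minWeight} {repairs} = record
  { columns = columnsOf v
  ; minWeight = toWitness minWeight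
  ; locality = repair⇒recoveryPair ∘ toWitness repairs }

simplex : LRC 5 31 16
simplex = explicit (Vec.tabulate (suc ∘ toℕ)) 16

code₁ : Vec ℕ 8
code₁ = 6 ∷ 11 ∷ 13 ∷ 14 ∷ 22 ∷ 22 ∷ 23 ∷ 25 ∷ []

code₂ : Vec ℕ 8
code₂ = 7 ∷ 9 ∷ 17 ∷ 18 ∷ 24 ∷ 26 ∷ 27 ∷ 29 ∷ []

code₃ : Vec ℕ 10
code₃ = 2 ∷ 7 ∷ 8 ∷ 9 ∷ 10 ∷ 11 ∷ 18 ∷ 22 ∷ 24 ∷ 31 ∷ []

code₄ : Vec ℕ 11
code₄ = 1 ∷ 2 ∷ 3 ∷ 4 ∷ 7 ∷ 9 ∷ 12 ∷ 17 ∷ 18 ∷ 27 ∷ 29 ∷ []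

code₅ : Vec ℕ 13
code₅ = 2 ∷ 6 ∷ 7 ∷ 10 ∷ 14 ∷ 16 ∷ 17 ∷ 19 ∷ 20 ∷ 21 ∷ 28 ∷ 30 ∷ 31 ∷ []

code₆ : Vec ℕ 14
code₆ = 2 ∷ 5 ∷ 6 ∷ 7 ∷ 8 ∷ 9 ∷ 10 ∷ 11 ∷ 17 ∷ 18 ∷ 22 ∷ 23 ∷ 26 ∷ 30 ∷ []

code₇ : Vec ℕ 16
code₇ = 1 ∷ 3 ∷ 3 ∷ 6 ∷ 7 ∷ 9 ∷ 11 ∷ 12 ∷ 14 ∷ 17 ∷ 19 ∷ 23 ∷ 26 ∷ 27 ∷ 30 ∷ 31 ∷ []

code₈ : Vec ℕ 17
code₈ = 2 ∷ 3 ∷ 6 ∷ 7 ∷ 10 ∷ 11 ∷ 12 ∷ 14 ∷ 15 ∷ 16 ∷ 17 ∷ 20 ∷ 21 ∷ 21 ∷ 24 ∷ 28 ∷ 29 ∷ []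

code₉ : Vec ℕ 20
code₉ = 1 ∷ 3 ∷ 5 ∷ 6 ∷ 7 ∷ 9 ∷ 11 ∷ 12 ∷ 13 ∷ 14 ∷ 15 ∷ 16 ∷ 17 ∷ 18 ∷ 21 ∷ 24 ∷ 25 ∷ 26 ∷ 27 ∷ 31 ∷
  []

code₁₀ : Vec ℕ 21
code₁₀ = 2 ∷ 3 ∷ 6 ∷ 7 ∷ 8 ∷ 10 ∷ 11 ∷ 12 ∷ 13 ∷ 14 ∷ 15 ∷ 16 ∷ 17 ∷ 20 ∷ 21 ∷ 23 ∷ 24 ∷ 25 ∷ 28 ∷
  29 ∷ 30 ∷ []

code₁₁ : Vec ℕ 23
code₁₁ = 1 ∷ 3 ∷ 4 ∷ 6 ∷ 9 ∷ 10 ∷ 11 ∷ 12 ∷ 13 ∷ 14 ∷ 15 ∷ 17 ∷ 19 ∷ 20 ∷ 22 ∷ 24 ∷ 25 ∷ 26 ∷ 27 ∷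
  28 ∷ 29 ∷ 30 ∷ 31 ∷ []

code₁₂ : Vec ℕ 24
code₁₂ = 1 ∷ 3 ∷ 4 ∷ 5 ∷ 6 ∷ 7 ∷ 8 ∷ 10 ∷ 12 ∷ 13 ∷ 14 ∷ 15 ∷ 16 ∷ 17 ∷ 18 ∷ 19 ∷ 21 ∷ 23 ∷ 24 ∷ 25 ∷
  26 ∷ 27 ∷ 28 ∷ 30 ∷ []

code₁₃ : Vec ℕ 27
code₁₃ = 1 ∷ 2 ∷ 3 ∷ 4 ∷ 5 ∷ 6 ∷ 8 ∷ 9 ∷ 10 ∷ 12 ∷ 13 ∷ 14 ∷ 15 ∷ 16 ∷ 18 ∷ 19 ∷ 20 ∷ 21 ∷ 23 ∷ 24 ∷
  25 ∷ 26 ∷ 27 ∷ 28 ∷ 29 ∷ 30 ∷ 31 ∷ []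

code₁₄ : Vec ℕ 28
code₁₄ = 1 ∷ 2 ∷ 3 ∷ 4 ∷ 6 ∷ 7 ∷ 8 ∷ 9 ∷ 11 ∷ 12 ∷ 13 ∷ 14 ∷ 16 ∷ 17 ∷ 18 ∷ 19 ∷ 20 ∷ 21 ∷ 22 ∷ 23 ∷
  24 ∷ 25 ∷ 26 ∷ 27 ∷ 28 ∷ 29 ∷ 30 ∷ 31 ∷ []

code₁₅ : Vec ℕ 30
code₁₅ = 1 ∷ 2 ∷ 3 ∷ 4 ∷ 5 ∷ 6 ∷ 7 ∷ 8 ∷ 9 ∷ 11 ∷ 12 ∷ 13 ∷ 14 ∷ 15 ∷ 16 ∷ 17 ∷ 18 ∷ 19 ∷ 20 ∷ 21 ∷
  22 ∷ 23 ∷ 24 ∷ 25 ∷ 26 ∷ 27 ∷ 28 ∷ 29 ∷ 30 ∷ 31 ∷ []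

code₁₇ : Vec ℕ 36
code₁₇ = 1 ∷ 2 ∷ 3 ∷ 4 ∷ 4 ∷ 5 ∷ 6 ∷ 7 ∷ 8 ∷ 9 ∷ 10 ∷ 10 ∷ 11 ∷ 12 ∷ 13 ∷ 13 ∷ 15 ∷ 15 ∷ 16 ∷ 17 ∷
  17 ∷ 18 ∷ 18 ∷ 19 ∷ 20 ∷ 21 ∷ 22 ∷ 23 ∷ 23 ∷ 24 ∷ 25 ∷ 25 ∷ 26 ∷ 27 ∷ 30 ∷ 31 ∷ []

code₁₈ : Vec ℕ 37
code₁₈ = 1 ∷ 2 ∷ 3 ∷ 5 ∷ 6 ∷ 7 ∷ 8 ∷ 9 ∷ 11 ∷ 12 ∷ 13 ∷ 14 ∷ 15 ∷ 16 ∷ 16 ∷ 17 ∷ 17 ∷ 18 ∷ 19 ∷ 19 ∷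
  20 ∷ 20 ∷ 21 ∷ 21 ∷ 22 ∷ 23 ∷ 24 ∷ 25 ∷ 25 ∷ 26 ∷ 27 ∷ 27 ∷ 28 ∷ 29 ∷ 30 ∷ 31 ∷ 31 ∷ []

code₁₉ : Vec ℕ 39
code₁₉ = 1 ∷ 1 ∷ 2 ∷ 3 ∷ 3 ∷ 4 ∷ 5 ∷ 5 ∷ 6 ∷ 7 ∷ 8 ∷ 9 ∷ 10 ∷ 11 ∷ 12 ∷ 12 ∷ 13 ∷ 14 ∷ 15 ∷ 16 ∷ 17 ∷
  18 ∷ 18 ∷ 19 ∷ 20 ∷ 20 ∷ 21 ∷ 22 ∷ 22 ∷ 24 ∷ 25 ∷ 26 ∷ 27 ∷ 27 ∷ 28 ∷ 28 ∷ 29 ∷ 30 ∷ 31 ∷ []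

code₂₀ : Vec ℕ 40
code₂₀ = 1 ∷ 2 ∷ 3 ∷ 3 ∷ 4 ∷ 5 ∷ 5 ∷ 6 ∷ 7 ∷ 7 ∷ 8 ∷ 9 ∷ 9 ∷ 11 ∷ 12 ∷ 13 ∷ 13 ∷ 14 ∷ 15 ∷ 15 ∷ 16 ∷
  16 ∷ 17 ∷ 18 ∷ 18 ∷ 19 ∷ 20 ∷ 22 ∷ 22 ∷ 23 ∷ 24 ∷ 24 ∷ 25 ∷ 26 ∷ 26 ∷ 27 ∷ 28 ∷ 28 ∷ 29 ∷ 30 ∷ []

code₂₁ : Vec ℕ 43
code₂₁ = 1 ∷ 2 ∷ 2 ∷ 3 ∷ 3 ∷ 4 ∷ 4 ∷ 5 ∷ 5 ∷ 6 ∷ 7 ∷ 8 ∷ 9 ∷ 10 ∷ 10 ∷ 11 ∷ 11 ∷ 12 ∷ 12 ∷ 13 ∷ 14 ∷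
  15 ∷ 16 ∷ 17 ∷ 18 ∷ 18 ∷ 19 ∷ 19 ∷ 20 ∷ 20 ∷ 21 ∷ 22 ∷ 24 ∷ 25 ∷ 26 ∷ 27 ∷ 27 ∷ 28 ∷ 28 ∷ 29 ∷ 29 ∷
  30 ∷ 31 ∷ []

code₂₂ : Vec ℕ 44
code₂₂ = 1 ∷ 2 ∷ 3 ∷ 3 ∷ 4 ∷ 5 ∷ 5 ∷ 6 ∷ 7 ∷ 7 ∷ 8 ∷ 8 ∷ 9 ∷ 10 ∷ 10 ∷ 11 ∷ 12 ∷ 14 ∷ 14 ∷ 15 ∷ 16 ∷
  16 ∷ 17 ∷ 18 ∷ 18 ∷ 19 ∷ 20 ∷ 20 ∷ 21 ∷ 22 ∷ 22 ∷ 23 ∷ 24 ∷ 25 ∷ 25 ∷ 26 ∷ 27 ∷ 27 ∷ 28 ∷ 29 ∷ 29 ∷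
  30 ∷ 31 ∷ 31 ∷ []

code₂₃ : Vec ℕ 46
code₂₃ = 1 ∷ 1 ∷ 2 ∷ 3 ∷ 4 ∷ 4 ∷ 5 ∷ 6 ∷ 6 ∷ 7 ∷ 8 ∷ 9 ∷ 9 ∷ 10 ∷ 11 ∷ 11 ∷ 12 ∷ 12 ∷ 13 ∷ 14 ∷ 14 ∷
  15 ∷ 16 ∷ 16 ∷ 17 ∷ 18 ∷ 18 ∷ 19 ∷ 20 ∷ 21 ∷ 21 ∷ 22 ∷ 23 ∷ 23 ∷ 24 ∷ 24 ∷ 25 ∷ 26 ∷ 26 ∷ 27 ∷ 28 ∷
  29 ∷ 29 ∷ 30 ∷ 31 ∷ 31 ∷ []

code₂₄ : Vec ℕ 47
code₂₄ = 1 ∷ 2 ∷ 2 ∷ 3 ∷ 3 ∷ 4 ∷ 4 ∷ 5 ∷ 5 ∷ 6 ∷ 7 ∷ 8 ∷ 9 ∷ 10 ∷ 10 ∷ 11 ∷ 11 ∷ 12 ∷ 12 ∷ 13 ∷ 13 ∷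
  14 ∷ 15 ∷ 16 ∷ 17 ∷ 18 ∷ 18 ∷ 19 ∷ 19 ∷ 20 ∷ 20 ∷ 21 ∷ 21 ∷ 22 ∷ 23 ∷ 24 ∷ 25 ∷ 26 ∷ 26 ∷ 27 ∷ 27 ∷
  28 ∷ 28 ∷ 29 ∷ 29 ∷ 30 ∷ 31 ∷ []

minLength-intro : ∀ {k d N} → HasCode N k d 2 → (∀ {m} → HasCode m k d 2 → N ≤ m) → MinLength≡ k d 2 N
minLength-intro code lower = code , λ m m<N code′ → <⇒≱ m<N (lower code′)

optimal-by-locality : ∀ {N d} .{{_ : NonZero d}} → LRC 5 N d → localityBound 5 d ≡ N → MinLength≡ 5 d 2 N
optimal-by-locality {d = d} C bound = minLength-intro (LRC⇒hasCode (>-nonZero⁻¹ d) C)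
  λ code → subst (_≤ _) bound (locality-lower (>-nonZero⁻¹ d) (s≤s (s≤s z≤n)) code)

optimal-short : ∀ {N d} → 3 ≤ d → LRC 5 N d → shortBound d ≡ N → MinLength≡ 5 d 2 N
optimal-short 3≤d C bound = minLength-intro (LRC⇒hasCode (≤-trans (s≤s z≤n) 3≤d) C)
  λ code → subst (_≤ _) bound (short-lower 3≤d code)

optimal-family : ∀ {N c} .{{_ : NonZero c}} → LRC 5 N c → griesmer 5 c ≡ N →
  ∀ t → MinLength≡ 5 (c + 16 * t) 2 (N + 31 * t)
optimal-family {N} {c} base meets t = minLength-intro upper lower
  where
  upper : HasCode (N + 31 * t) 5 (c + 16 * t) 2
  upper = subst₂ (λ n d → HasCode n 5 d 2) (cong (N +_) (*-comm t 31)) (cong (c +_) (*-comm t 16))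
    (LRC⇒hasCode (≤-trans (>-nonZero⁻¹ c) (m≤m+n c _)) (base ⊞ repeat simplex t))
  lower : ∀ {m} → HasCode m 5 (c + 16 * t) 2 → N + 31 * t ≤ m
  lower {m} code = subst (_≤ m) (trans (griesmer₅-shift c t) (cong (_+ 31 * t) meets)) (griesmer-lower code)

theorem29 : ((t : ℕ) →
    MinLength≡ 5 (9 + 16 * t) 2 (20 + 31 * t) ×
    MinLength≡ 5 (10 + 16 * t) 2 (21 + 31 * t) ×
    MinLength≡ 5 (11 + 16 * t) 2 (23 + 31 * t) ×
    MinLength≡ 5 (12 + 16 * t) 2 (24 + 31 * t) ×
    MinLength≡ 5 (13 + 16 * t) 2 (27 + 31 * t) ×
    MinLength≡ 5 (14 + 16 * t) 2 (28 + 31 * t) ×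
    MinLength≡ 5 (15 + 16 * t) 2 (30 + 31 * t) ×
    MinLength≡ 5 (16 + 16 * t) 2 (31 + 31 * t) ×
    MinLength≡ 5 (17 + 16 * t) 2 (36 + 31 * t) ×
    MinLength≡ 5 (18 + 16 * t) 2 (37 + 31 * t) ×
    MinLength≡ 5 (19 + 16 * t) 2 (39 + 31 * t) ×
    MinLength≡ 5 (20 + 16 * t) 2 (40 + 31 * t) ×
    MinLength≡ 5 (21 + 16 * t) 2 (43 + 31 * t) ×
    MinLength≡ 5 (22 + 16 * t) 2 (44 + 31 * t) ×
    MinLength≡ 5 (23 + 16 * t) 2 (46 + 31 * t) ×
    MinLength≡ 5 (24 + 16 * t) 2 (47 + 31 * t)) ×
    MinLength≡ 5 1 2 8 ×
    MinLength≡ 5 2 2 8 ×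
    MinLength≡ 5 3 2 10 ×
    MinLength≡ 5 4 2 11 ×
    MinLength≡ 5 5 2 13 ×
    MinLength≡ 5 6 2 14 ×
    MinLength≡ 5 7 2 16 ×
    MinLength≡ 5 8 2 17
theorem29 =
  (λ t → optimal-family (explicit code₉ 9) refl t , optimal-family (explicit code₁₀ 10) refl t ,
         optimal-family (explicit code₁₁ 11) refl t , optimal-family (explicit code₁₂ 12) refl t ,
         optimal-family (explicit code₁₃ 13) refl t , optimal-family (explicit code₁₄ 14) refl t ,
         optimal-family (explicit code₁₅ 15) refl t , optimal-family simplex refl t ,
         optimal-family (explicit code₁₇ 17) refl t , optimal-family (explicit code₁₈ 18) refl t ,
         optimal-family (explicit code₁₉ 19) refl t , optimal-family (explicit code₂₀ 20) refl t ,
         optimal-family (explicit code₂₁ 21) refl t , optimal-family (explicit code₂₂ 22) refl t ,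
         optimal-family (explicit code₂₃ 23) refl t , optimal-family (explicit code₂₄ 24) refl t) ,
  optimal-by-locality (explicit code₁ 1) refl ,
  optimal-by-locality (explicit code₂ 2) refl ,
  optimal-short (s≤s (s≤s (s≤s z≤n))) (explicit code₃ 3) refl ,
  optimal-short (s≤s (s≤s (s≤s z≤n))) (explicit code₄ 4) refl ,
  optimal-by-locality (explicit code₅ 5) refl ,
  optimal-by-locality (explicit code₆ 6) refl ,
  optimal-by-locality (explicit code₇ 7) refl ,
  optimal-by-locality (explicit code₈ 8) refl
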